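{- In $\mathbb{Z}[q,q^{ -1}][[x,y]]$, $$\sum_{i=1}^{\infty}q^i[i]!\,x^iy^i\prod_{j=0}^i\frac{1}{q^j-q^j[j+1]x+[j]xy}=\frac{ -y}{q(1-x)}+\sum_{i\ge1}\frac{q^{ -i^2-i-1}y^i(q^{2i+1}-y)}{q^i-q^i[i+1]x+[i]xy}.$$
   Context: For $m\ge0$, $[m]=1+q+\dots+q^{m-1}$ (so $[0]=0$) and $[i]!=\prod_{m=1}^i[m]$. Each reciprocal of the form $1/(q^j-q^j[j+1]x+[j]xy)$ (and $1/(1-x)$) denotes the inverse in $\mathbb{Z}[q,q^{ -1}][[x,y]]$, which exists since the constant term is a unit. -}

module Defs where

open import Data.Nat using (ℕ; zero; suc; _∸_) renaming (_+_ to _+ℕ_)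
open import Data.Integer using (ℤ; +_; -[1+_]; ∣_∣; _⊓_) renaming (_+_ to _+ℤ_; _*_ to _*ℤ_; -_ to -ℤ_; _-_ to _-ℤ_)
open import Data.List using (List; []; _∷_; map; replicate; _++_)
open import Relation.Binary.PropositionalEquality using (_≡_)

-- Laurent polynomials  ℤ[q,q⁻¹]
-- A Laurent polynomial is represented by a lowest exponent `lo` and a
-- list of coefficients: lp lo (c₀ ∷ c₁ ∷ …) = Σₖ cₖ q^(lo+k).

record LP : Set where
  constructor lp
  field
    lo : ℤ
    cs : List ℤ
open LP public

lookupD : List ℤ → ℕ → ℤ
lookupD []       _       = + 0
lookupD (c ∷ _)  zero    = c
lookupD (_ ∷ cs) (suc n) = lookupD cs n

coeffL : LP → ℤ → ℤ
coeffL (lp l cs) k with k -ℤ l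
... | + n      = lookupD cs n
... | -[1+ _ ] = + 0

_≈L_ : LP → LP → Set
p ≈L r = ∀ k → coeffL p k ≡ coeffL r k

addL : List ℤ → List ℤ → List ℤ
addL []       r        = r
addL (c ∷ cs) []       = c ∷ cs
addL (c ∷ cs) (d ∷ ds) = (c +ℤ d) ∷ addL cs ds

mulL : List ℤ → List ℤ → List ℤ
mulL []       r = []
mulL (c ∷ cs) r = addL (map (c *ℤ_) r) (+ 0 ∷ mulL cs r)

infixl 6 _⊕_
infixl 7 _⊗_

_⊕_ : LP → LP → LP
lp l₁ c₁ ⊕ lp l₂ c₂ =
  lp m (addL (replicate ∣ l₁ -ℤ m ∣ (+ 0) ++ c₁) (replicate ∣ l₂ -ℤ m ∣ (+ 0) ++ c₂))
  where m = l₁ ⊓ l₂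

_⊗_ : LP → LP → LP
lp l₁ c₁ ⊗ lp l₂ c₂ = lp (l₁ +ℤ l₂) (mulL c₁ c₂)

negL : LP → LP
negL (lp l cs) = lp l (map -ℤ_ cs)

zeroL : LP
zeroL = lp (+ 0) []

qpow : ℤ → LP
qpow k = lp k (+ 1 ∷ [])

oneL : LP
oneL = qpow (+ 0)

sumTo : ℕ → (ℕ → LP) → LP
sumTo zero    F = F 0
sumTo (suc n) F = sumTo n F ⊕ F (suc n)

qint : ℕ → LP
qint zero    = zeroL
qint (suc m) = qint m ⊕ qpow (+ m)

qfact : ℕ → LP
qfact zero    = oneL
qfact (suc i) = qfact i ⊗ qint (suc i)

-- Formal power series ℤ[q,q⁻¹][[x,y]] : coefficient of x^a y^b.

PS : Set
PS = ℕ → ℕ → LP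

_≈S_ : PS → PS → Set
f ≈S g = ∀ a b → f a b ≈L g a b

infixl 6 _+S_ _-S_
infixl 7 _*S_

_+S_ : PS → PS → PS
(f +S g) a b = f a b ⊕ g a b

negS : PS → PS
negS f a b = negL (f a b)

_-S_ : PS → PS → PS
f -S g = f +S negS g

_*S_ : PS → PS → PS
(f *S g) a b = sumTo a (λ i → sumTo b (λ j → f i j ⊗ g (a ∸ i) (b ∸ j)))

constS : LP → PS
constS c zero zero = c
constS c _    _    = zeroL

oneS : PS
oneS = constS oneL

X : PS
X (suc zero) zero = oneL
X _          _    = zeroL

Y : PS
Y zero (suc zero) = oneL
Y _    _          = zeroL

powS : PS → ℕ → PS
powS f zero    = oneS
powS f (suc n) = powS f n *S f

prodTo : ℕ → (ℕ → PS) → PS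
prodTo zero    F = F 0
prodTo (suc n) F = prodTo n F *S F (suc n)

-- Inverse of a series f whose constant term has inverse u (u * f₀₀ = 1):
-- 1/f = u · Σ_{n≥0} h^n  with  h = 1 - u f  (h has zero constant term, so
-- only n ≤ a+b contribute to the coefficient of x^a y^b).
invS : PS → LP → PS
invS f u a b = u ⊗ sumTo (a +ℕ b) (λ n → powS h n a b)
  where h = oneS -S (constS u *S f)

-- Σ_{i≥1} T i, for families with T i ∈ (x,y)^i (so only i ≤ a+b
-- contribute to the coefficient of x^a y^b).
tsum1 : (ℕ → PS) → PS
tsum1 T a b = sumTo (a +ℕ b) (λ i → T (suc i) a b)

Den : ℕ → PS
Den j = constS (qpow (+ j)) -S constS (qpow (+ j) ⊗ qint (suc j)) *S X
        +S constS (qint j) *S X *S Y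

invDen : ℕ → PS
invDen j = invS (Den j) (qpow (-ℤ (+ j)))

{-# OPTIONS --safe #-}

-- Write Dⱼ = qʲ - qʲ[j+1]x + [j]xy, Iⱼ = 1/Dⱼ, and for k, m ≥ 0
--   t k m = q^(m+k-k²) [m]! xᵐ y^(k+m) Iₖ⋯I_(k+m),
--   A k m = q^(-(k²+k+1)) [m]! xᵐ y^(k+m+1) Iₖ⋯I_(k+m),
-- so that the left-hand side is ∑_(m≥1) t 0 m and the k-th summand r k of the
-- right-hand side is q^(-(k²+k+1)) yᵏ (q^(2k+1) - y) Iₖ.  The denominators satisfy
--   q^(m+1) Dₖ - D_(k+m+1) = [m+1] x (q^(2k+m+2) - y),
-- and multiplying by Iₖ⋯I_(k+m+1) gives t k (m+1) + A k m = A k (m+1) + t (k+1) m,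
-- while r k + A k 0 = t k 0.  Hence ∑_(m≤M) t k m telescopes to ∑_(i≤M) r (k+i)
-- up to a multiple of y^(k+M+1), and r 0 = t 0 0 - y/(q(1-x)) turns this, for
-- k = 0, into the identity modulo y^(M+2) for every M.
--
-- A series f whose constant term has inverse u is inverted by u ∑ₙ (1 - u f)ⁿ;
-- truncated at n = N this is exact below total degree N + 1.

module Submission where

open import Defs

open import Algebra.Bundles using (CommutativeRing)
open import Algebra.Structures using (IsCommutativeRing)
import Algebra.Solver.CommutativeMonoid
import Algebra.Solver.Ring
open import Algebra.Solver.Ring.AlmostCommutativeRing using (fromCommutativeRing; _-Raw-AlmostCommutative⟶_)
open import Data.Integer as ℤ using (ℤ; +_; -[1+_]; _⊖_; ∣_∣)
  renaming (_+_ to _+ℤ_; _-_ to _-ℤ_; _*_ to _*ℤ_; -_ to -ℤ_)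
import Data.Integer.Properties as ℤ
open import Data.Integer.Properties using (≤-refl; ≤-reflexive; i⊓j≤i; i⊓j≤j)
open import Data.Integer.Tactic.RingSolver using (solve-∀)
open import Data.List using (List; []; _∷_; map; replicate; _++_)
open import Data.Maybe using (Maybe; just; nothing)
open import Data.Nat as ℕ using (ℕ; zero; suc; _∸_; _≤_; _<_; z≤n; s≤s)
import Data.Nat.Properties as ℕ
open import Data.Product using (_,_)
open import Data.Sum using (inj₁; inj₂)
open import Relation.Binary.Bundles using (Setoid)
open import Relation.Binary.PropositionalEquality as ≡ using (_≡_; cong; cong₂; module ≡-Reasoning)
open import Relation.Nullary using (yes; no)

-- Finite sums and Cauchy products

module FiniteSums {c ℓ} (R : CommutativeRing c ℓ) where

  open CommutativeRing R
  open import Relation.Binary.Reasoning.Setoid setoid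
  open import Algebra.Properties.CommutativeSemigroup +-commutativeSemigroup using (interchange)

  ∑ : ℕ → (ℕ → Carrier) → Carrier
  ∑ zero    f = f 0
  ∑ (suc n) f = ∑ n f + f (suc n)

  ∑-cong : ∀ n {f g} → (∀ i → i ≤ n → f i ≈ g i) → ∑ n f ≈ ∑ n g
  ∑-cong zero    f≈g = f≈g 0 z≤n
  ∑-cong (suc n) f≈g =
    +-cong (∑-cong n (λ i i≤n → f≈g i (ℕ.m≤n⇒m≤1+n i≤n))) (f≈g (suc n) ℕ.≤-refl)

  ∑-congᵖ : ∀ n {f g} → (∀ i → f i ≈ g i) → ∑ n f ≈ ∑ n g
  ∑-congᵖ n f≈g = ∑-cong n (λ i _ → f≈g i)

  ∑-zero : ∀ n f → (∀ i → i ≤ n → f i ≈ 0#) → ∑ n f ≈ 0#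
  ∑-zero zero    f f≈0 = f≈0 0 z≤n
  ∑-zero (suc n) f f≈0 = begin
    ∑ n f + f (suc n) ≈⟨ +-cong (∑-zero n f (λ i i≤n → f≈0 i (ℕ.m≤n⇒m≤1+n i≤n))) (f≈0 (suc n) ℕ.≤-refl) ⟩
    0# + 0#           ≈⟨ +-identityˡ 0# ⟩
    0#                ∎

  ∑-head : ∀ n f → (∀ i → f (suc i) ≈ 0#) → ∑ n f ≈ f 0
  ∑-head zero    f f≈0 = refl
  ∑-head (suc n) f f≈0 = begin
    ∑ n f + f (suc n) ≈⟨ +-cong (∑-head n f f≈0) (f≈0 n) ⟩
    f 0 + 0#          ≈⟨ +-identityʳ (f 0) ⟩
    f 0               ∎

  ∑-distrib-+ : ∀ n f g → ∑ n (λ i → f i + g i) ≈ ∑ n f + ∑ n g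
  ∑-distrib-+ zero    f g = refl
  ∑-distrib-+ (suc n) f g = trans (+-congʳ (∑-distrib-+ n f g)) (interchange _ _ _ _)

  *-distribˡ-∑ : ∀ n x f → x * ∑ n f ≈ ∑ n (λ i → x * f i)
  *-distribˡ-∑ zero    x f = refl
  *-distribˡ-∑ (suc n) x f = trans (distribˡ x _ _) (+-congʳ (*-distribˡ-∑ n x f))

  *-distribʳ-∑ : ∀ n x f → ∑ n f * x ≈ ∑ n (λ i → f i * x)
  *-distribʳ-∑ zero    x f = refl
  *-distribʳ-∑ (suc n) x f = trans (distribʳ x _ _) (+-congʳ (*-distribʳ-∑ n x f))

  ∑-peel : ∀ n f → ∑ (suc n) f ≈ f 0 + ∑ n (λ i → f (suc i))
  ∑-peel zero    f = refl
  ∑-peel (suc n) f = trans (+-congʳ (∑-peel n f)) (+-assoc _ _ _)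

  ∑-truncate : ∀ {m} n f → m ≤ n → (∀ i → m < i → f i ≈ 0#) → ∑ n f ≈ ∑ m f
  ∑-truncate zero    f z≤n   _   = refl
  ∑-truncate {m} (suc n) f m≤1+n f≈0 with ℕ.m≤n⇒m<n∨m≡n m≤1+n
  ... | inj₂ ≡.refl    = refl
  ... | inj₁ (s≤s m≤n) = begin
    ∑ n f + f (suc n) ≈⟨ +-cong (∑-truncate n f m≤n f≈0) (f≈0 (suc n) (s≤s m≤n)) ⟩
    ∑ m f + 0#        ≈⟨ +-identityʳ _ ⟩
    ∑ m f             ∎

  ∑-reverse : ∀ n f → ∑ n f ≈ ∑ n (λ i → f (n ∸ i))
  ∑-reverse zero    f = refl
  ∑-reverse (suc n) f = begin
    ∑ n f + f (suc n)                 ≈⟨ +-congʳ (∑-reverse n f) ⟩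
    ∑ n (λ i → f (n ∸ i)) + f (suc n) ≈⟨ +-comm _ _ ⟩
    f (suc n) + ∑ n (λ i → f (n ∸ i)) ≈⟨ ∑-peel n (λ i → f (suc n ∸ i)) ⟨
    ∑ (suc n) (λ i → f (suc n ∸ i))   ∎

  ∑-triangle : ∀ n (F : ℕ → ℕ → Carrier) →
               ∑ n (λ i → ∑ i (λ j → F j (i ∸ j))) ≈ ∑ n (λ j → ∑ (n ∸ j) (F j))
  ∑-triangle zero    F = refl
  ∑-triangle (suc n) F = begin
    ∑ n (λ i → ∑ i (λ j → F j (i ∸ j))) + (∑ n (λ j → F j (suc n ∸ j)) + F (suc n) (n ∸ n))
      ≈⟨ +-congʳ (∑-triangle n F) ⟩
    ∑ n (λ j → ∑ (n ∸ j) (F j)) + (∑ n (λ j → F j (suc n ∸ j)) + F (suc n) (n ∸ n))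
      ≈⟨ +-assoc _ _ _ ⟨
    (∑ n (λ j → ∑ (n ∸ j) (F j)) + ∑ n (λ j → F j (suc n ∸ j))) + F (suc n) (n ∸ n)
      ≈⟨ +-congʳ (∑-distrib-+ n _ _) ⟨
    ∑ n (λ j → ∑ (n ∸ j) (F j) + F j (suc n ∸ j)) + F (suc n) (n ∸ n)
      ≈⟨ +-cong (∑-cong n extend) last ⟩
    ∑ n (λ j → ∑ (suc n ∸ j) (F j)) + ∑ (n ∸ n) (F (suc n)) ∎
    where
    extend : ∀ j → j ≤ n → ∑ (n ∸ j) (F j) + F j (suc n ∸ j) ≈ ∑ (suc n ∸ j) (F j)
    extend j j≤n rewrite ℕ.+-∸-assoc 1 j≤n = refl
    last : F (suc n) (n ∸ n) ≈ ∑ (n ∸ n) (F (suc n))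
    last rewrite ℕ.n∸n≡0 n = refl

module CauchyProduct {c ℓ} (R : CommutativeRing c ℓ) where

  open CommutativeRing R
  open FiniteSums R public
  open import Relation.Binary.Reasoning.Setoid setoid

  Seq : Set c
  Seq = ℕ → Carrier

  -- A record rather than a bare ∀ n → …, so that the implicit arguments
  -- of the ring laws stay inferable.
  infix 4 _≈ₛ_
  record _≈ₛ_ (f g : Seq) : Set ℓ where
    constructor mk≈ₛ
    field un≈ₛ : ∀ n → f n ≈ g n
  open _≈ₛ_ public

  _+ₛ_ : Seq → Seq → Seq
  (f +ₛ g) n = f n + g n

  -ₛ_ : Seq → Seq
  (-ₛ f) n = - f n

  0ₛ : Seq
  0ₛ _ = 0#

  1ₛ : Seq
  1ₛ zero    = 1#
  1ₛ (suc _) = 0#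

  _⋆_ : Seq → Seq → Seq
  (f ⋆ g) n = ∑ n (λ i → f i * g (n ∸ i))

  ⋆-cong : ∀ {f f′ g g′} → (∀ n → f n ≈ f′ n) → (∀ n → g n ≈ g′ n) → ∀ n → (f ⋆ g) n ≈ (f′ ⋆ g′) n
  ⋆-cong f≈f′ g≈g′ n = ∑-congᵖ n (λ i → *-cong (f≈f′ i) (g≈g′ (n ∸ i)))

  ⋆-congˡ : ∀ {f f′} g → (∀ n → f n ≈ f′ n) → ∀ n → (f ⋆ g) n ≈ (f′ ⋆ g) n
  ⋆-congˡ g f≈f′ = ⋆-cong f≈f′ (λ n → refl {g n})

  ⋆-congʳ : ∀ f {g g′} → (∀ n → g n ≈ g′ n) → ∀ n → (f ⋆ g) n ≈ (f ⋆ g′) n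
  ⋆-congʳ f g≈g′ = ⋆-cong (λ n → refl {f n}) g≈g′

  ⋆-comm : ∀ f g n → (f ⋆ g) n ≈ (g ⋆ f) n
  ⋆-comm f g n = trans (∑-reverse n _) (∑-cong n (λ i i≤n →
    trans (*-comm _ _) (*-congʳ (reflexive (≡.cong g (ℕ.m∸[m∸n]≡n i≤n))))))

  ⋆-assoc : ∀ f g h n → ((f ⋆ g) ⋆ h) n ≈ (f ⋆ (g ⋆ h)) n
  ⋆-assoc f g h n = begin
    ∑ n (λ i → ∑ i (λ j → f j * g (i ∸ j)) * h (n ∸ i))
      ≈⟨ ∑-congᵖ n (λ i → *-distribʳ-∑ i _ _) ⟩
    ∑ n (λ i → ∑ i (λ j → (f j * g (i ∸ j)) * h (n ∸ i)))
      ≈⟨ ∑-cong n (λ i i≤n → ∑-cong i (λ j j≤i →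
           trans (*-assoc _ _ _) (*-congˡ (*-congˡ (reflexive (≡.cong h (reindex i≤n j≤i))))))) ⟩
    ∑ n (λ i → ∑ i (λ j → G j (i ∸ j)))
      ≈⟨ ∑-triangle n G ⟩
    ∑ n (λ j → ∑ (n ∸ j) (G j))
      ≈⟨ ∑-congᵖ n (λ j → *-distribˡ-∑ (n ∸ j) _ _) ⟨
    ∑ n (λ j → f j * ∑ (n ∸ j) (λ k → g k * h (n ∸ j ∸ k))) ∎
    where
    G : ℕ → ℕ → Carrier
    G j k = f j * (g k * h (n ∸ j ∸ k))
    reindex : ∀ {i j} → i ≤ n → j ≤ i → n ∸ i ≡ n ∸ j ∸ (i ∸ j)
    reindex {i} {j} i≤n j≤i =
      ≡.trans (≡.cong (n ∸_) (≡.sym (ℕ.m+[n∸m]≡n j≤i))) (≡.sym (ℕ.∸-+-assoc n j (i ∸ j)))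

  ⋆-identityˡ : ∀ f n → (1ₛ ⋆ f) n ≈ f n
  ⋆-identityˡ f zero    = *-identityˡ _
  ⋆-identityˡ f (suc n) = begin
    ∑ (suc n) (λ i → 1ₛ i * f (suc n ∸ i))      ≈⟨ ∑-peel n _ ⟩
    1# * f (suc n) + ∑ n (λ i → 0# * f (n ∸ i)) ≈⟨ +-cong (*-identityˡ _) (∑-zero n _ (λ i _ → zeroˡ _)) ⟩
    f (suc n) + 0#                              ≈⟨ +-identityʳ _ ⟩
    f (suc n)                                   ∎

  ⋆-distribˡ : ∀ f g h n → (f ⋆ (g +ₛ h)) n ≈ ((f ⋆ g) +ₛ (f ⋆ h)) n
  ⋆-distribˡ f g h n = trans (∑-congᵖ n (λ i → distribˡ _ _ _)) (∑-distrib-+ n _ _)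

  ⋆-isCommutativeRing : IsCommutativeRing _≈ₛ_ _+ₛ_ _⋆_ -ₛ_ 0ₛ 1ₛ
  ⋆-isCommutativeRing = record
    { isRing = record
      { +-isAbelianGroup = record
        { isGroup = record
          { isMonoid = record
            { isSemigroup = record
              { isMagma = record
                { isEquivalence = record
                  { refl  = mk≈ₛ (λ _ → refl)
                  ; sym   = λ p → mk≈ₛ (λ n → sym (un≈ₛ p n))
                  ; trans = λ p q → mk≈ₛ (λ n → trans (un≈ₛ p n) (un≈ₛ q n)) }
                ; ∙-cong = λ p q → mk≈ₛ (λ n → +-cong (un≈ₛ p n) (un≈ₛ q n)) }
              ; assoc = λ _ _ _ → mk≈ₛ (λ _ → +-assoc _ _ _) }
            ; identity = (λ _ → mk≈ₛ (λ _ → +-identityˡ _)) , (λ _ → mk≈ₛ (λ _ → +-identityʳ _)) }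
          ; inverse = (λ _ → mk≈ₛ (λ _ → -‿inverseˡ _)) , (λ _ → mk≈ₛ (λ _ → -‿inverseʳ _))
          ; ⁻¹-cong = λ p → mk≈ₛ (λ n → -‿cong (un≈ₛ p n)) }
        ; comm = λ _ _ → mk≈ₛ (λ _ → +-comm _ _) }
      ; *-cong = λ p q → mk≈ₛ (⋆-cong (un≈ₛ p) (un≈ₛ q))
      ; *-assoc = λ f g h → mk≈ₛ (⋆-assoc f g h)
      ; *-identity = (λ f → mk≈ₛ (⋆-identityˡ f))
                   , (λ f → mk≈ₛ (λ n → trans (⋆-comm f 1ₛ n) (⋆-identityˡ f n)))
      ; distrib = (λ f g h → mk≈ₛ (⋆-distribˡ f g h))
                , (λ f g h → mk≈ₛ (λ n → begin
                    ((g +ₛ h) ⋆ f) n        ≈⟨ ⋆-comm (g +ₛ h) f n ⟩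
                    (f ⋆ (g +ₛ h)) n        ≈⟨ ⋆-distribˡ f g h n ⟩
                    (f ⋆ g) n + (f ⋆ h) n   ≈⟨ +-cong (⋆-comm f g n) (⋆-comm f h n) ⟩
                    (g ⋆ f) n + (h ⋆ f) n   ∎)) }
    ; *-comm = λ f g → mk≈ₛ (⋆-comm f g) }

  cauchyRing : CommutativeRing c ℓ
  cauchyRing = record { isCommutativeRing = ⋆-isCommutativeRing }

-- Laurent polynomials

module ℤ-Cauchy = CauchyProduct ℤ.+-*-commutativeRing
open ℤ-Cauchy using (_⋆_; 1ₛ; ⋆-cong; ⋆-congˡ; ⋆-congʳ; ⋆-comm; ⋆-assoc; ⋆-identityˡ; ⋆-distribˡ)

pad : ℕ → List ℤ → List ℤ
pad d cs = replicate d (+ 0) ++ cs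

shift : ℕ → (ℕ → ℤ) → ℕ → ℤ
shift zero    f n       = f n
shift (suc d) f zero    = + 0
shift (suc d) f (suc n) = shift d f n

shift-cong : ∀ d {f g} → (∀ n → f n ≡ g n) → ∀ n → shift d f n ≡ shift d g n
shift-cong zero    f≡g n       = f≡g n
shift-cong (suc d) f≡g zero    = ≡.refl
shift-cong (suc d) f≡g (suc n) = shift-cong d f≡g n

shift-+ : ∀ d e f n → shift (d ℕ.+ e) f n ≡ shift d (shift e f) n
shift-+ zero    e f n       = ≡.refl
shift-+ (suc d) e f zero    = ≡.refl
shift-+ (suc d) e f (suc n) = shift-+ d e f n

shift-⋆ˡ : ∀ d f g n → (shift d f ⋆ g) n ≡ shift d (f ⋆ g) n
shift-⋆ˡ zero    f g n       = ≡.refl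
shift-⋆ˡ (suc d) f g zero    = ℤ.*-zeroˡ (g 0)
shift-⋆ˡ (suc d) f g (suc n) = begin
  (shift (suc d) f ⋆ g) (suc n)         ≡⟨ ℤ-Cauchy.∑-peel n _ ⟩
  + 0 *ℤ g (suc n) +ℤ (shift d f ⋆ g) n ≡⟨ ℤ.+-identityˡ _ ⟩
  (shift d f ⋆ g) n                     ≡⟨ shift-⋆ˡ d f g n ⟩
  shift d (f ⋆ g) n                     ∎
  where open ≡-Reasoning

shift-⋆ : ∀ d e f g n → (shift d f ⋆ shift e g) n ≡ shift (d ℕ.+ e) (f ⋆ g) n
shift-⋆ d e f g n = begin
  (shift d f ⋆ shift e g) n   ≡⟨ shift-⋆ˡ d f (shift e g) n ⟩
  shift d (f ⋆ shift e g) n   ≡⟨ shift-cong d (λ m → ⋆-comm f (shift e g) m) n ⟩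
  shift d (shift e g ⋆ f) n   ≡⟨ shift-cong d (λ m → shift-⋆ˡ e g f m) n ⟩
  shift d (shift e (g ⋆ f)) n ≡⟨ shift-cong d (shift-cong e (⋆-comm g f)) n ⟩
  shift d (shift e (f ⋆ g)) n ≡⟨ shift-+ d e (f ⋆ g) n ⟨
  shift (d ℕ.+ e) (f ⋆ g) n   ∎
  where open ≡-Reasoning

lookupD-pad : ∀ d cs n → lookupD (pad d cs) n ≡ shift d (lookupD cs) n
lookupD-pad zero    cs n       = ≡.refl
lookupD-pad (suc d) cs zero    = ≡.refl
lookupD-pad (suc d) cs (suc n) = lookupD-pad d cs n

lookupD-addL : ∀ a b n → lookupD (addL a b) n ≡ lookupD a n +ℤ lookupD b n
lookupD-addL []       b        n       = ≡.sym (ℤ.+-identityˡ _)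
lookupD-addL (c ∷ cs) []       n       = ≡.sym (ℤ.+-identityʳ _)
lookupD-addL (c ∷ cs) (d ∷ ds) zero    = ≡.refl
lookupD-addL (c ∷ cs) (d ∷ ds) (suc n) = lookupD-addL cs ds n

lookupD-map : ∀ (f : ℤ → ℤ) → f (+ 0) ≡ + 0 → ∀ cs n → lookupD (map f cs) n ≡ f (lookupD cs n)
lookupD-map f f0≡0 []       n       = ≡.sym f0≡0
lookupD-map f f0≡0 (c ∷ cs) zero    = ≡.refl
lookupD-map f f0≡0 (c ∷ cs) (suc n) = lookupD-map f f0≡0 cs n

lookupD-mulL : ∀ a b n → lookupD (mulL a b) n ≡ (lookupD a ⋆ lookupD b) n
lookupD-mulL []       b n       = ≡.sym (ℤ-Cauchy.∑-zero n _ (λ i _ → ℤ.*-zeroˡ (lookupD b (n ℕ.∸ i))))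
lookupD-mulL (c ∷ cs) b zero    = begin
  lookupD (addL (map (c *ℤ_) b) (+ 0 ∷ mulL cs b)) 0 ≡⟨ lookupD-addL (map (c *ℤ_) b) _ 0 ⟩
  lookupD (map (c *ℤ_) b) 0 +ℤ + 0                   ≡⟨ ℤ.+-identityʳ _ ⟩
  lookupD (map (c *ℤ_) b) 0                          ≡⟨ lookupD-map (c *ℤ_) (ℤ.*-zeroʳ c) b 0 ⟩
  c *ℤ lookupD b 0                                   ∎
  where open ≡-Reasoning
lookupD-mulL (c ∷ cs) b (suc n) = begin
  lookupD (addL (map (c *ℤ_) b) (+ 0 ∷ mulL cs b)) (suc n)
    ≡⟨ lookupD-addL (map (c *ℤ_) b) _ (suc n) ⟩
  lookupD (map (c *ℤ_) b) (suc n) +ℤ lookupD (mulL cs b) n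
    ≡⟨ cong₂ _+ℤ_ (lookupD-map (c *ℤ_) (ℤ.*-zeroʳ c) b (suc n)) (lookupD-mulL cs b n) ⟩
  c *ℤ lookupD b (suc n) +ℤ (lookupD cs ⋆ lookupD b) n
    ≡⟨ ℤ-Cauchy.∑-peel n _ ⟨
  (lookupD (c ∷ cs) ⋆ lookupD b) (suc n) ∎
  where open ≡-Reasoning

lookZ : List ℤ → ℤ → ℤ
lookZ cs (+ n)    = lookupD cs n
lookZ cs -[1+ _ ] = + 0

coeffL-lookZ : ∀ l cs k → coeffL (lp l cs) k ≡ lookZ cs (k -ℤ l)
coeffL-lookZ l cs k with k -ℤ l
... | + n      = ≡.refl
... | -[1+ _ ] = ≡.refl

lookZ-⊖ : ∀ cs n d → lookZ cs (n ⊖ d) ≡ shift d (lookupD cs) n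
lookZ-⊖ cs n       zero    = cong (lookZ cs) (ℤ.⊖-≥ {n} {0} ℕ.z≤n)
lookZ-⊖ cs zero    (suc d) = cong (lookZ cs) (ℤ.⊖-< (ℕ.s≤s (ℕ.z≤n {d})))
lookZ-⊖ cs (suc n) (suc d) = ≡.trans (cong (lookZ cs) (ℤ.[1+m]⊖[1+n]≡m⊖n n d)) (lookZ-⊖ cs n d)

private
  i+[j-i]≡j : ∀ L l → L +ℤ (l -ℤ L) ≡ l
  i+[j-i]≡j = solve-∀
  [i+j]-[i+k]≡j-k : ∀ L x y → (L +ℤ x) -ℤ (L +ℤ y) ≡ x -ℤ y
  [i+j]-[i+k]≡j-k = solve-∀
  i-[j+k]≡i-j-k : ∀ k L d → k -ℤ (L +ℤ d) ≡ (k -ℤ L) -ℤ d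
  i-[j+k]≡i-j-k = solve-∀

offset : ∀ {L l} → L ℤ.≤ l → l ≡ L +ℤ + ∣ l -ℤ L ∣
offset {L} {l} L≤l =
  ≡.trans (≡.sym (i+[j-i]≡j L l)) (cong (λ z → L +ℤ z) (≡.sym (ℤ.0≤i⇒+∣i∣≡i (ℤ.i≤j⇒0≤j-i L≤l))))

coeffL-offset : ∀ L {l} cs d n → l ≡ L +ℤ + d → coeffL (lp l cs) (L +ℤ + n) ≡ shift d (lookupD cs) n
coeffL-offset L cs d n ≡.refl = begin
  coeffL (lp (L +ℤ + d) cs) (L +ℤ + n) ≡⟨ coeffL-lookZ (L +ℤ + d) cs (L +ℤ + n) ⟩
  lookZ cs ((L +ℤ + n) -ℤ (L +ℤ + d))  ≡⟨ cong (lookZ cs) (≡.trans ([i+j]-[i+k]≡j-k L (+ n) (+ d)) (ℤ.[+m]-[+n]≡m⊖n n d)) ⟩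
  lookZ cs (n ⊖ d)                     ≡⟨ lookZ-⊖ cs n d ⟩
  shift d (lookupD cs) n               ∎
  where open ≡-Reasoning

coeffL-below : ∀ L {l} cs d k j → l ≡ L +ℤ + d → k -ℤ L ≡ -[1+ j ] → coeffL (lp l cs) k ≡ + 0
coeffL-below L cs d k j ≡.refl k-L≡-[1+j] = begin
  coeffL (lp (L +ℤ + d) cs) k ≡⟨ coeffL-lookZ (L +ℤ + d) cs k ⟩
  lookZ cs (k -ℤ (L +ℤ + d))  ≡⟨ cong (lookZ cs) (≡.trans (i-[j+k]≡i-j-k k L (+ d)) (cong (_-ℤ + d) k-L≡-[1+j])) ⟩
  lookZ cs (-[1+ j ] -ℤ + d)  ≡⟨ negative d ⟩
  + 0                         ∎
  where
  open ≡-Reasoning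
  negative : ∀ d → lookZ cs (-[1+ j ] -ℤ + d) ≡ + 0
  negative zero    = cong (lookZ cs) (ℤ.+-identityʳ -[1+ j ])
  negative (suc d) = ≡.refl

offset-split : ∀ (F G : ℤ → ℤ) L → (∀ n → F (L +ℤ + n) ≡ G (L +ℤ + n)) →
               (∀ k j → k -ℤ L ≡ -[1+ j ] → F k ≡ G k) → ∀ k → F k ≡ G k
offset-split F G L above below k with k -ℤ L in eq
... | + n      = ≡.subst (λ k′ → F k′ ≡ G k′) (≡.trans (cong (λ z → L +ℤ z) (≡.sym eq)) (i+[j-i]≡j L k)) (above n)
... | -[1+ j ] = below k j eq

≈L-from-offset : ∀ p r L → L ℤ.≤ lo p → L ℤ.≤ lo r →
                 (∀ n → coeffL p (L +ℤ + n) ≡ coeffL r (L +ℤ + n)) → p ≈L r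
≈L-from-offset (lp l₁ c₁) (lp l₂ c₂) L L≤l₁ L≤l₂ above =
  offset-split _ _ L above (λ k j k<L →
    ≡.trans (coeffL-below L c₁ _ k j (offset L≤l₁) k<L) (≡.sym (coeffL-below L c₂ _ k j (offset L≤l₂) k<L)))

coeffL-⊕ : ∀ p r k → coeffL (p ⊕ r) k ≡ coeffL p k +ℤ coeffL r k
coeffL-⊕ (lp l₁ c₁) (lp l₂ c₂) = offset-split _ _ m above below
  where
  m = l₁ ℤ.⊓ l₂
  m≡m+0 : m ≡ m +ℤ + 0
  m≡m+0 = ≡.sym (ℤ.+-identityʳ m)
  d₁ = ∣ l₁ -ℤ m ∣
  d₂ = ∣ l₂ -ℤ m ∣
  above : ∀ n → coeffL (lp l₁ c₁ ⊕ lp l₂ c₂) (m +ℤ + n)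
                ≡ coeffL (lp l₁ c₁) (m +ℤ + n) +ℤ coeffL (lp l₂ c₂) (m +ℤ + n)
  above n = begin
    coeffL (lp l₁ c₁ ⊕ lp l₂ c₂) (m +ℤ + n)
      ≡⟨ coeffL-offset m _ 0 n m≡m+0 ⟩
    lookupD (addL (pad d₁ c₁) (pad d₂ c₂)) n
      ≡⟨ lookupD-addL (pad d₁ c₁) (pad d₂ c₂) n ⟩
    lookupD (pad d₁ c₁) n +ℤ lookupD (pad d₂ c₂) n
      ≡⟨ cong₂ _+ℤ_ (lookupD-pad d₁ c₁ n) (lookupD-pad d₂ c₂ n) ⟩
    shift d₁ (lookupD c₁) n +ℤ shift d₂ (lookupD c₂) n
      ≡⟨ cong₂ _+ℤ_ (coeffL-offset m c₁ d₁ n (offset (ℤ.i⊓j≤i l₁ l₂))) (coeffL-offset m c₂ d₂ n (offset (ℤ.i⊓j≤j l₁ l₂))) ⟨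
    coeffL (lp l₁ c₁) (m +ℤ + n) +ℤ coeffL (lp l₂ c₂) (m +ℤ + n) ∎
    where open ≡-Reasoning
  below : ∀ k j → k -ℤ m ≡ -[1+ j ] → coeffL (lp l₁ c₁ ⊕ lp l₂ c₂) k ≡ coeffL (lp l₁ c₁) k +ℤ coeffL (lp l₂ c₂) k
  below k j k<m = ≡.trans (coeffL-below m _ 0 k j m≡m+0 k<m) (≡.sym (cong₂ _+ℤ_
    (coeffL-below m c₁ d₁ k j (offset (ℤ.i⊓j≤i l₁ l₂)) k<m) (coeffL-below m c₂ d₂ k j (offset (ℤ.i⊓j≤j l₁ l₂)) k<m)))

coeffL-negL : ∀ p k → coeffL (negL p) k ≡ -ℤ coeffL p k
coeffL-negL (lp l cs) k with k -ℤ l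
... | + n      = lookupD-map -ℤ_ ≡.refl cs n
... | -[1+ _ ] = ≡.refl

coeffL-zeroL : ∀ k → coeffL zeroL k ≡ + 0
coeffL-zeroL k with k -ℤ + 0
... | + n      = ≡.refl
... | -[1+ _ ] = ≡.refl

coeffs : LP → ℤ → ℕ → ℤ
coeffs p L n = coeffL p (L +ℤ + n)

coeffL-⊗ : ∀ p r {L₁ L₂} → L₁ ℤ.≤ lo p → L₂ ℤ.≤ lo r →
           ∀ n → coeffL (p ⊗ r) ((L₁ +ℤ L₂) +ℤ + n) ≡ (coeffs p L₁ ⋆ coeffs r L₂) n
coeffL-⊗ (lp l₁ c₁) (lp l₂ c₂) {L₁} {L₂} L₁≤l₁ L₂≤l₂ n = begin
  coeffL (lp (l₁ +ℤ l₂) (mulL c₁ c₂)) ((L₁ +ℤ L₂) +ℤ + n)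
    ≡⟨ coeffL-offset (L₁ +ℤ L₂) (mulL c₁ c₂) (d₁ ℕ.+ d₂) n l₁+l₂≡ ⟩
  shift (d₁ ℕ.+ d₂) (lookupD (mulL c₁ c₂)) n
    ≡⟨ shift-cong (d₁ ℕ.+ d₂) (lookupD-mulL c₁ c₂) n ⟩
  shift (d₁ ℕ.+ d₂) (lookupD c₁ ⋆ lookupD c₂) n
    ≡⟨ shift-⋆ d₁ d₂ (lookupD c₁) (lookupD c₂) n ⟨
  (shift d₁ (lookupD c₁) ⋆ shift d₂ (lookupD c₂)) n
    ≡⟨ ⋆-cong (λ m → coeffL-offset L₁ c₁ d₁ m (offset L₁≤l₁)) (λ m → coeffL-offset L₂ c₂ d₂ m (offset L₂≤l₂)) n ⟨
  (coeffs (lp l₁ c₁) L₁ ⋆ coeffs (lp l₂ c₂) L₂) n ∎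
  where
  open ≡-Reasoning
  d₁ = ∣ l₁ -ℤ L₁ ∣
  d₂ = ∣ l₂ -ℤ L₂ ∣
  interchange : ∀ a b c d → (a +ℤ c) +ℤ (b +ℤ d) ≡ (a +ℤ b) +ℤ (c +ℤ d)
  interchange = solve-∀
  l₁+l₂≡ : l₁ +ℤ l₂ ≡ (L₁ +ℤ L₂) +ℤ + (d₁ ℕ.+ d₂)
  l₁+l₂≡ = ≡.trans (cong₂ _+ℤ_ (offset L₁≤l₁) (offset L₂≤l₂)) (interchange L₁ L₂ (+ d₁) (+ d₂))


-- At a common lower bound of the exponents, ⊗ is the Cauchy product of the
-- coefficient sequences, so the multiplicative laws come from those of _⋆_.
⊗-comm : ∀ p r → (p ⊗ r) ≈L (r ⊗ p)
⊗-comm p r = ≈L-from-offset (p ⊗ r) (r ⊗ p) (a +ℤ b) ≤-refl (≤-reflexive (ℤ.+-comm a b)) λ n → begin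
  coeffL (p ⊗ r) ((a +ℤ b) +ℤ + n) ≡⟨ coeffL-⊗ p r ≤-refl ≤-refl n ⟩
  (coeffs p a ⋆ coeffs r b) n      ≡⟨ ⋆-comm (coeffs p a) (coeffs r b) n ⟩
  (coeffs r b ⋆ coeffs p a) n      ≡⟨ coeffL-⊗ r p ≤-refl ≤-refl n ⟨
  coeffL (r ⊗ p) ((b +ℤ a) +ℤ + n) ≡⟨ cong (λ z → coeffL (r ⊗ p) (z +ℤ + n)) (ℤ.+-comm b a) ⟩
  coeffL (r ⊗ p) ((a +ℤ b) +ℤ + n) ∎
  where
  open ≡-Reasoning
  a = lo p
  b = lo r

⊗-assoc : ∀ p r s → ((p ⊗ r) ⊗ s) ≈L (p ⊗ (r ⊗ s))
⊗-assoc p r s = ≈L-from-offset ((p ⊗ r) ⊗ s) (p ⊗ (r ⊗ s)) ((a +ℤ b) +ℤ c) ≤-refl (≤-reflexive (ℤ.+-assoc a b c)) λ n → begin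
  coeffL ((p ⊗ r) ⊗ s) (((a +ℤ b) +ℤ c) +ℤ + n) ≡⟨ coeffL-⊗ (p ⊗ r) s ≤-refl ≤-refl n ⟩
  (coeffs (p ⊗ r) (a +ℤ b) ⋆ coeffs s c) n      ≡⟨ ⋆-congˡ (coeffs s c) (coeffL-⊗ p r ≤-refl ≤-refl) n ⟩
  ((coeffs p a ⋆ coeffs r b) ⋆ coeffs s c) n    ≡⟨ ⋆-assoc (coeffs p a) (coeffs r b) (coeffs s c) n ⟩
  (coeffs p a ⋆ (coeffs r b ⋆ coeffs s c)) n    ≡⟨ ⋆-congʳ (coeffs p a) (coeffL-⊗ r s ≤-refl ≤-refl) n ⟨
  (coeffs p a ⋆ coeffs (r ⊗ s) (b +ℤ c)) n      ≡⟨ coeffL-⊗ p (r ⊗ s) ≤-refl ≤-refl n ⟨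
  coeffL (p ⊗ (r ⊗ s)) ((a +ℤ (b +ℤ c)) +ℤ + n) ≡⟨ cong (λ z → coeffL (p ⊗ (r ⊗ s)) (z +ℤ + n)) (ℤ.+-assoc a b c) ⟨
  coeffL (p ⊗ (r ⊗ s)) (((a +ℤ b) +ℤ c) +ℤ + n) ∎
  where
  open ≡-Reasoning
  a = lo p
  b = lo r
  c = lo s

⊗-identityˡ : ∀ p → (oneL ⊗ p) ≈L p
⊗-identityˡ p = ≈L-from-offset (oneL ⊗ p) p (+ 0 +ℤ a) ≤-refl (≤-reflexive (ℤ.+-identityˡ a)) λ n → begin
  coeffL (oneL ⊗ p) ((+ 0 +ℤ a) +ℤ + n) ≡⟨ coeffL-⊗ oneL p ≤-refl ≤-refl n ⟩
  (coeffs oneL (+ 0) ⋆ coeffs p a) n    ≡⟨ ⋆-congˡ (coeffs p a) coeffs-oneL n ⟩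
  (1ₛ ⋆ coeffs p a) n                   ≡⟨ ⋆-identityˡ (coeffs p a) n ⟩
  coeffL p (a +ℤ + n)                   ≡⟨ cong (λ z → coeffL p (z +ℤ + n)) (ℤ.+-identityˡ a) ⟨
  coeffL p ((+ 0 +ℤ a) +ℤ + n)          ∎
  where
  open ≡-Reasoning
  a = lo p
  coeffs-oneL : ∀ m → coeffs oneL (+ 0) m ≡ 1ₛ m
  coeffs-oneL zero    = ≡.refl
  coeffs-oneL (suc m) = ≡.refl

⊗-distribˡ : ∀ p r s → (p ⊗ (r ⊕ s)) ≈L ((p ⊗ r) ⊕ (p ⊗ s))
⊗-distribˡ p r s = ≈L-from-offset (p ⊗ (r ⊕ s)) ((p ⊗ r) ⊕ (p ⊗ s)) (a +ℤ m) ≤-refl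
  (ℤ.⊓-glb (ℤ.+-monoʳ-≤ a (i⊓j≤i (lo r) (lo s))) (ℤ.+-monoʳ-≤ a (i⊓j≤j (lo r) (lo s)))) λ n → begin
    coeffL (p ⊗ (r ⊕ s)) ((a +ℤ m) +ℤ + n)
      ≡⟨ coeffL-⊗ p (r ⊕ s) ≤-refl ≤-refl n ⟩
    (coeffs p a ⋆ coeffs (r ⊕ s) m) n
      ≡⟨ ⋆-congʳ (coeffs p a) (λ j → coeffL-⊕ r s (m +ℤ + j)) n ⟩
    (coeffs p a ⋆ (λ j → coeffs r m j +ℤ coeffs s m j)) n
      ≡⟨ ⋆-distribˡ (coeffs p a) (coeffs r m) (coeffs s m) n ⟩
    (coeffs p a ⋆ coeffs r m) n +ℤ (coeffs p a ⋆ coeffs s m) n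
      ≡⟨ cong₂ _+ℤ_ (coeffL-⊗ p r ≤-refl (i⊓j≤i (lo r) (lo s)) n) (coeffL-⊗ p s ≤-refl (i⊓j≤j (lo r) (lo s)) n) ⟨
    coeffL (p ⊗ r) ((a +ℤ m) +ℤ + n) +ℤ coeffL (p ⊗ s) ((a +ℤ m) +ℤ + n)
      ≡⟨ coeffL-⊕ (p ⊗ r) (p ⊗ s) ((a +ℤ m) +ℤ + n) ⟨
    coeffL ((p ⊗ r) ⊕ (p ⊗ s)) ((a +ℤ m) +ℤ + n) ∎
  where
  open ≡-Reasoning
  a = lo p
  m = lo r ℤ.⊓ lo s

⊗-cong : ∀ {p p′ r r′} → p ≈L p′ → r ≈L r′ → (p ⊗ r) ≈L (p′ ⊗ r′)
⊗-cong {p} {p′} {r} {r′} p≈p′ r≈r′ =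
  ≈L-from-offset (p ⊗ r) (p′ ⊗ r′) (L₁ +ℤ L₂) (ℤ.+-mono-≤ L₁≤p L₂≤r) (ℤ.+-mono-≤ L₁≤p′ L₂≤r′) λ n → begin
    coeffL (p ⊗ r) ((L₁ +ℤ L₂) +ℤ + n)   ≡⟨ coeffL-⊗ p r L₁≤p L₂≤r n ⟩
    (coeffs p L₁ ⋆ coeffs r L₂) n        ≡⟨ ⋆-cong (λ j → p≈p′ (L₁ +ℤ + j)) (λ j → r≈r′ (L₂ +ℤ + j)) n ⟩
    (coeffs p′ L₁ ⋆ coeffs r′ L₂) n      ≡⟨ coeffL-⊗ p′ r′ L₁≤p′ L₂≤r′ n ⟨
    coeffL (p′ ⊗ r′) ((L₁ +ℤ L₂) +ℤ + n) ∎
  where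
  open ≡-Reasoning
  L₁ = lo p ℤ.⊓ lo p′
  L₂ = lo r ℤ.⊓ lo r′
  L₁≤p = i⊓j≤i (lo p) (lo p′)
  L₁≤p′ = i⊓j≤j (lo p) (lo p′)
  L₂≤r = i⊓j≤i (lo r) (lo r′)
  L₂≤r′ = i⊓j≤j (lo r) (lo r′)

module _ where
  open ≡-Reasoning

  ⊕-cong : ∀ {p p′ r r′} → p ≈L p′ → r ≈L r′ → (p ⊕ r) ≈L (p′ ⊕ r′)
  ⊕-cong {p} {p′} {r} {r′} p≈p′ r≈r′ k = begin
    coeffL (p ⊕ r) k           ≡⟨ coeffL-⊕ p r k ⟩
    coeffL p k +ℤ coeffL r k   ≡⟨ cong₂ _+ℤ_ (p≈p′ k) (r≈r′ k) ⟩
    coeffL p′ k +ℤ coeffL r′ k ≡⟨ coeffL-⊕ p′ r′ k ⟨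
    coeffL (p′ ⊕ r′) k         ∎

  ⊕-assoc : ∀ p r s → ((p ⊕ r) ⊕ s) ≈L (p ⊕ (r ⊕ s))
  ⊕-assoc p r s k = begin
    coeffL ((p ⊕ r) ⊕ s) k                   ≡⟨ coeffL-⊕ (p ⊕ r) s k ⟩
    coeffL (p ⊕ r) k +ℤ coeffL s k           ≡⟨ cong (_+ℤ coeffL s k) (coeffL-⊕ p r k) ⟩
    (coeffL p k +ℤ coeffL r k) +ℤ coeffL s k ≡⟨ ℤ.+-assoc (coeffL p k) (coeffL r k) (coeffL s k) ⟩
    coeffL p k +ℤ (coeffL r k +ℤ coeffL s k) ≡⟨ cong (coeffL p k +ℤ_) (coeffL-⊕ r s k) ⟨
    coeffL p k +ℤ coeffL (r ⊕ s) k           ≡⟨ coeffL-⊕ p (r ⊕ s) k ⟨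
    coeffL (p ⊕ (r ⊕ s)) k                   ∎

  ⊕-comm : ∀ p r → (p ⊕ r) ≈L (r ⊕ p)
  ⊕-comm p r k = begin
    coeffL (p ⊕ r) k         ≡⟨ coeffL-⊕ p r k ⟩
    coeffL p k +ℤ coeffL r k ≡⟨ ℤ.+-comm (coeffL p k) (coeffL r k) ⟩
    coeffL r k +ℤ coeffL p k ≡⟨ coeffL-⊕ r p k ⟨
    coeffL (r ⊕ p) k         ∎

  ⊕-identityˡ : ∀ p → (zeroL ⊕ p) ≈L p
  ⊕-identityˡ p k = begin
    coeffL (zeroL ⊕ p) k         ≡⟨ coeffL-⊕ zeroL p k ⟩
    coeffL zeroL k +ℤ coeffL p k ≡⟨ cong (_+ℤ coeffL p k) (coeffL-zeroL k) ⟩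
    + 0 +ℤ coeffL p k            ≡⟨ ℤ.+-identityˡ (coeffL p k) ⟩
    coeffL p k                   ∎

  negL-inverseˡ : ∀ p → (negL p ⊕ p) ≈L zeroL
  negL-inverseˡ p k = begin
    coeffL (negL p ⊕ p) k           ≡⟨ coeffL-⊕ (negL p) p k ⟩
    coeffL (negL p) k +ℤ coeffL p k ≡⟨ cong (_+ℤ coeffL p k) (coeffL-negL p k) ⟩
    -ℤ coeffL p k +ℤ coeffL p k     ≡⟨ ℤ.+-inverseˡ (coeffL p k) ⟩
    + 0                             ≡⟨ coeffL-zeroL k ⟨
    coeffL zeroL k                  ∎

  negL-cong : ∀ {p p′} → p ≈L p′ → negL p ≈L negL p′
  negL-cong {p} {p′} p≈p′ k = begin
    coeffL (negL p) k  ≡⟨ coeffL-negL p k ⟩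
    -ℤ coeffL p k      ≡⟨ cong -ℤ_ (p≈p′ k) ⟩
    -ℤ coeffL p′ k     ≡⟨ coeffL-negL p′ k ⟨
    coeffL (negL p′) k ∎

infix 4 _≋_
record _≋_ (p r : LP) : Set where
  constructor mk≋
  field un≋ : p ≈L r
open _≋_ public

laurentIsCommutativeRing : IsCommutativeRing _≋_ _⊕_ _⊗_ negL zeroL oneL
laurentIsCommutativeRing = record
  { isRing = record
    { +-isAbelianGroup = record
      { isGroup = record
        { isMonoid = record
          { isSemigroup = record
            { isMagma = record
              { isEquivalence = record
                { refl  = mk≋ (λ _ → ≡.refl)
                ; sym   = λ p≋r → mk≋ (λ k → ≡.sym (un≋ p≋r k))
                ; trans = λ p≋r r≋s → mk≋ (λ k → ≡.trans (un≋ p≋r k) (un≋ r≋s k)) }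
              ; ∙-cong = λ p≋p′ r≋r′ → mk≋ (⊕-cong (un≋ p≋p′) (un≋ r≋r′)) }
            ; assoc = λ p r s → mk≋ (⊕-assoc p r s) }
          ; identity = (λ p → mk≋ (⊕-identityˡ p))
                     , (λ p → mk≋ (λ k → ≡.trans (⊕-comm p zeroL k) (⊕-identityˡ p k))) }
        ; inverse = (λ p → mk≋ (negL-inverseˡ p))
                  , (λ p → mk≋ (λ k → ≡.trans (⊕-comm p (negL p) k) (negL-inverseˡ p k)))
        ; ⁻¹-cong = λ p≋p′ → mk≋ (negL-cong (un≋ p≋p′)) }
      ; comm = λ p r → mk≋ (⊕-comm p r) }
    ; *-cong = λ p≋p′ r≋r′ → mk≋ (⊗-cong (un≋ p≋p′) (un≋ r≋r′))
    ; *-assoc = λ p r s → mk≋ (⊗-assoc p r s)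
    ; *-identity = (λ p → mk≋ (⊗-identityˡ p))
                 , (λ p → mk≋ (λ k → ≡.trans (⊗-comm p oneL k) (⊗-identityˡ p k)))
    ; distrib = (λ p r s → mk≋ (⊗-distribˡ p r s))
              , (λ p r s → mk≋ (λ k → ≡.trans (⊗-comm (r ⊕ s) p k)
                                     (≡.trans (⊗-distribˡ p r s k) (⊕-cong (⊗-comm p r) (⊗-comm p s) k)))) }
  ; *-comm = λ p r → mk≋ (⊗-comm p r) }

laurentRing : CommutativeRing _ _
laurentRing = record { isCommutativeRing = laurentIsCommutativeRing }

-- Power series

module L = CommutativeRing laurentRing
module LaurentSeq = CauchyProduct laurentRing
module DoubleSeq = CauchyProduct LaurentSeq.cauchyRing

infix 4 _≈ᴾ_
record _≈ᴾ_ (f g : PS) : Set where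
  constructor mk≈ᴾ
  field un≈ᴾ : ∀ a b → f a b ≋ g a b
open _≈ᴾ_ public

zeroS : PS
zeroS _ _ = zeroL

toDouble : ∀ {f g} → f ≈ᴾ g → f DoubleSeq.≈ₛ g
toDouble f≈g = DoubleSeq.mk≈ₛ (λ a → LaurentSeq.mk≈ₛ (un≈ᴾ f≈g a))

fromDouble : ∀ {f g} → f DoubleSeq.≈ₛ g → f ≈ᴾ g
fromDouble f≈g = mk≈ᴾ (λ a → LaurentSeq.un≈ₛ (DoubleSeq.un≈ₛ f≈g a))

sumTo≡∑ : ∀ n f → sumTo n f ≡ LaurentSeq.∑ n f
sumTo≡∑ zero    f = ≡.refl
sumTo≡∑ (suc n) f = cong (_⊕ f (suc n)) (sumTo≡∑ n f)

*S-coeff : ∀ f g a b → (f *S g) a b ≋ LaurentSeq.∑ a (λ i → LaurentSeq.∑ b (λ j → f i j ⊗ g (a ∸ i) (b ∸ j)))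
*S-coeff f g a b = L.trans (L.reflexive (sumTo≡∑ a _)) (LaurentSeq.∑-congᵖ a (λ i → L.reflexive (sumTo≡∑ b _)))

∑-pointwise : ∀ n (F : ℕ → ℕ → LP) b → DoubleSeq.∑ n F b ≡ LaurentSeq.∑ n (λ i → F i b)
∑-pointwise zero    F b = ≡.refl
∑-pointwise (suc n) F b = cong (_⊕ F (suc n) b) (∑-pointwise n F b)

*S≈⋆ : ∀ f g → (f *S g) ≈ᴾ (f DoubleSeq.⋆ g)
*S≈⋆ f g = mk≈ᴾ (λ a b → L.trans (*S-coeff f g a b) (L.reflexive (≡.sym (∑-pointwise a _ b))))

private
  module D = CommutativeRing DoubleSeq.cauchyRing

oneS≈1 : oneS ≈ᴾ DoubleSeq.1ₛ
oneS≈1 = mk≈ᴾ coeff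
  where
  coeff : ∀ a b → oneS a b ≋ DoubleSeq.1ₛ a b
  coeff zero    zero    = L.refl
  coeff zero    (suc b) = L.refl
  coeff (suc a) b       = L.refl

-- Every law is transported from the Cauchy product ring of sequences of
-- sequences, which differs from PS only in how *S is computed.
powerSeriesIsCommutativeRing : IsCommutativeRing _≈ᴾ_ _+S_ _*S_ negS zeroS oneS
powerSeriesIsCommutativeRing = record
  { isRing = record
    { +-isAbelianGroup = record
      { isGroup = record
        { isMonoid = record
          { isSemigroup = record
            { isMagma = record
              { isEquivalence = record
                { refl  = fromDouble D.refl
                ; sym   = λ f≈g → fromDouble (D.sym (toDouble f≈g))
                ; trans = λ f≈g g≈h → fromDouble (D.trans (toDouble f≈g) (toDouble g≈h)) }
              ; ∙-cong = λ f≈f′ g≈g′ → fromDouble (D.+-cong (toDouble f≈f′) (toDouble g≈g′)) }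
            ; assoc = λ f g h → fromDouble (D.+-assoc f g h) }
          ; identity = (λ f → fromDouble (D.+-identityˡ f)) , (λ f → fromDouble (D.+-identityʳ f)) }
        ; inverse = (λ f → fromDouble (D.-‿inverseˡ f)) , (λ f → fromDouble (D.-‿inverseʳ f))
        ; ⁻¹-cong = λ f≈g → fromDouble (D.-‿cong (toDouble f≈g)) }
      ; comm = λ f g → fromDouble (D.+-comm f g) }
    ; *-cong = λ {f} {f′} {g} {g′} f≈f′ g≈g′ → fromDouble (begin
        f *S g   ≈⟨ toDouble (*S≈⋆ f g) ⟩
        f ⊛ g    ≈⟨ D.*-cong (toDouble f≈f′) (toDouble g≈g′) ⟩
        f′ ⊛ g′  ≈⟨ toDouble (*S≈⋆ f′ g′) ⟨
        f′ *S g′ ∎)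
    ; *-assoc = λ f g h → fromDouble (begin
        (f *S g) *S h ≈⟨ toDouble (*S≈⋆ (f *S g) h) ⟩
        (f *S g) ⊛ h  ≈⟨ D.*-cong (toDouble (*S≈⋆ f g)) (D.refl {h}) ⟩
        (f ⊛ g) ⊛ h   ≈⟨ D.*-assoc f g h ⟩
        f ⊛ (g ⊛ h)   ≈⟨ D.*-cong (D.refl {f}) (toDouble (*S≈⋆ g h)) ⟨
        f ⊛ (g *S h)  ≈⟨ toDouble (*S≈⋆ f (g *S h)) ⟨
        f *S (g *S h) ∎)
    ; *-identity = (λ f → fromDouble (begin
          oneS *S f        ≈⟨ toDouble (*S≈⋆ oneS f) ⟩
          oneS ⊛ f         ≈⟨ D.*-cong (toDouble oneS≈1) (D.refl {f}) ⟩
          DoubleSeq.1ₛ ⊛ f ≈⟨ D.*-identityˡ f ⟩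
          f                ∎))
      , (λ f → fromDouble (begin
          f *S oneS        ≈⟨ toDouble (*S≈⋆ f oneS) ⟩
          f ⊛ oneS         ≈⟨ D.*-cong (D.refl {f}) (toDouble oneS≈1) ⟩
          f ⊛ DoubleSeq.1ₛ ≈⟨ D.*-identityʳ f ⟩
          f                ∎))
    ; distrib = (λ f g h → fromDouble (begin
          f *S (g +S h)    ≈⟨ toDouble (*S≈⋆ f (g +S h)) ⟩
          f ⊛ (g +S h)     ≈⟨ D.distribˡ f g h ⟩
          f ⊛ g +S f ⊛ h   ≈⟨ D.+-cong (toDouble (*S≈⋆ f g)) (toDouble (*S≈⋆ f h)) ⟨
          f *S g +S f *S h ∎))
      , (λ f g h → fromDouble (begin
          (g +S h) *S f         ≈⟨ toDouble (*S≈⋆ (g +S h) f) ⟩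
          (g +S h) ⊛ f          ≈⟨ D.distribʳ f g h ⟩
          g ⊛ f +S h ⊛ f        ≈⟨ D.+-cong (toDouble (*S≈⋆ g f)) (toDouble (*S≈⋆ h f)) ⟨
          g *S f +S h *S f      ∎)) }
  ; *-comm = λ f g → fromDouble (begin
      f *S g   ≈⟨ toDouble (*S≈⋆ f g) ⟩
      f ⊛ g    ≈⟨ D.*-comm f g ⟩
      g ⊛ f    ≈⟨ toDouble (*S≈⋆ g f) ⟨
      g *S f   ∎) }
  where
  open DoubleSeq using () renaming (_⋆_ to _⊛_)
  open import Relation.Binary.Reasoning.Setoid D.setoid

powerSeriesRing : CommutativeRing _ _
powerSeriesRing = record { isCommutativeRing = powerSeriesIsCommutativeRing }

module S = CommutativeRing powerSeriesRing

constS-*S : ∀ c f a b → (constS c *S f) a b ≋ c ⊗ f a b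
constS-*S c f a b = begin
  (constS c *S f) a b
    ≈⟨ *S-coeff (constS c) f a b ⟩
  ∑ a (λ i → ∑ b (λ j → constS c i j ⊗ f (a ∸ i) (b ∸ j)))
    ≈⟨ ∑-head a _ (λ i → ∑-zero b _ (λ j _ → L.zeroˡ (f (a ∸ suc i) (b ∸ j)))) ⟩
  ∑ b (λ j → constS c 0 j ⊗ f a (b ∸ j))
    ≈⟨ ∑-head b _ (λ j → L.zeroˡ (f a (b ∸ suc j))) ⟩
  c ⊗ f a b ∎
  where
  open LaurentSeq using (∑; ∑-head; ∑-zero)
  open import Relation.Binary.Reasoning.Setoid L.setoid

constS-cong : ∀ {p r} → p ≋ r → constS p ≈ᴾ constS r
constS-cong {p} {r} p≋r = mk≈ᴾ coeff
  where
  coeff : ∀ a b → constS p a b ≋ constS r a b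
  coeff zero    zero    = p≋r
  coeff zero    (suc b) = L.refl
  coeff (suc a) b       = L.refl

constS-⊕ : ∀ p r → constS (p ⊕ r) ≈ᴾ constS p +S constS r
constS-⊕ p r = mk≈ᴾ coeff
  where
  coeff : ∀ a b → constS (p ⊕ r) a b ≋ (constS p +S constS r) a b
  coeff zero    zero    = L.refl
  coeff zero    (suc b) = L.sym (L.+-identityˡ zeroL)
  coeff (suc a) b       = L.sym (L.+-identityˡ zeroL)

constS-⊗ : ∀ p r → constS (p ⊗ r) ≈ᴾ constS p *S constS r
constS-⊗ p r = mk≈ᴾ (λ a b → L.trans (coeff a b) (L.sym (constS-*S p (constS r) a b)))
  where
  coeff : ∀ a b → constS (p ⊗ r) a b ≋ p ⊗ constS r a b
  coeff zero    zero    = L.refl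
  coeff zero    (suc b) = L.sym (L.zeroʳ p)
  coeff (suc a) b       = L.sym (L.zeroʳ p)

constS-negL : ∀ p → constS (negL p) ≈ᴾ negS (constS p)
constS-negL p = mk≈ᴾ coeff
  where
  coeff : ∀ a b → constS (negL p) a b ≋ negS (constS p) a b
  coeff zero    zero    = L.refl
  coeff zero    (suc b) = L.refl
  coeff (suc a) b       = L.refl

constS-zeroL : constS zeroL ≈ᴾ zeroS
constS-zeroL = mk≈ᴾ coeff
  where
  coeff : ∀ a b → constS zeroL a b ≋ zeroS a b
  coeff zero    zero    = L.refl
  coeff zero    (suc b) = L.refl
  coeff (suc a) b       = L.refl

-- The ring solver for series works with integer coefficients.
ℤ↦PS : ℤ → PS
ℤ↦PS n = constS (lp (+ 0) (n ∷ []))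

ℤ↦PS-morphism : CommutativeRing.rawRing ℤ.+-*-commutativeRing -Raw-AlmostCommutative⟶ fromCommutativeRing powerSeriesRing
ℤ↦PS-morphism = record
  { ⟦_⟧    = ℤ↦PS
  ; +-homo = λ m n → constS-⊕ (lp (+ 0) (m ∷ [])) (lp (+ 0) (n ∷ []))
  ; *-homo = λ m n → S.trans (constS-cong (L.reflexive (cong (λ z → lp (+ 0) (z ∷ [])) (≡.sym (ℤ.+-identityʳ (m *ℤ n))))))
                             (constS-⊗ (lp (+ 0) (m ∷ [])) (lp (+ 0) (n ∷ [])))
  ; -‿homo = λ m → constS-negL (lp (+ 0) (m ∷ []))
  ; 0-homo = S.trans (constS-cong (mk≋ [0]≈[])) constS-zeroL
  ; 1-homo = S.refl }
  where
  [0]≈[] : lp (+ 0) (+ 0 ∷ []) ≈L zeroL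
  [0]≈[] k with k -ℤ + 0
  ... | + zero    = ≡.refl
  ... | + suc _   = ≡.refl
  ... | -[1+ _ ]  = ≡.refl

ℤ↦PS-≟ : ∀ m n → Maybe (ℤ↦PS m ≈ᴾ ℤ↦PS n)
ℤ↦PS-≟ m n with m ℤ.≟ n
... | yes ≡.refl = just S.refl
... | no _       = nothing

module RingSolver = Algebra.Solver.Ring (CommutativeRing.rawRing ℤ.+-*-commutativeRing)
                     (fromCommutativeRing powerSeriesRing) ℤ↦PS-morphism ℤ↦PS-≟
open RingSolver public using (solve; _:=_; _:+_; _:*_; _:-_; con)

-- Orders of vanishing

-- Opened only from here on: in the ring modules above it would clash with the ring's _+_.
open import Data.Nat using (_+_)

module Series = FiniteSums powerSeriesRing

∑-coeff : ∀ n (F : ℕ → PS) a b → Series.∑ n F a b ≡ LaurentSeq.∑ n (λ i → F i a b)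
∑-coeff zero    F a b = ≡.refl
∑-coeff (suc n) F a b = cong (_⊕ F (suc n) a b) (∑-coeff n F a b)

Additive : (ℕ → ℕ → ℕ) → Set
Additive w = ∀ {a b i j} → i ≤ a → j ≤ b → w i j + w (a ∸ i) (b ∸ j) ≡ w a b

module Order (w : ℕ → ℕ → ℕ) (w-additive : Additive w) where

  infix 4 _≈[_]_
  _≈[_]_ : PS → ℕ → PS → Set
  f ≈[ n ] g = ∀ a b → w a b < n → f a b ≋ g a b

  HasOrder : ℕ → PS → Set
  HasOrder n f = f ≈[ n ] zeroS

  ≈[]-setoid : ℕ → Setoid _ _
  ≈[]-setoid n = record
    { _≈_ = _≈[ n ]_
    ; isEquivalence = record
      { refl  = λ a b _ → L.refl
      ; sym   = λ f≈g a b lt → L.sym (f≈g a b lt)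
      ; trans = λ f≈g g≈h a b lt → L.trans (f≈g a b lt) (g≈h a b lt) } }

  ≈ᴾ⇒≈[] : ∀ {f g} n → f ≈ᴾ g → f ≈[ n ] g
  ≈ᴾ⇒≈[] n f≈g a b _ = un≈ᴾ f≈g a b

  +S-cong-≈[] : ∀ {f f′ g g′} n → f ≈[ n ] f′ → g ≈[ n ] g′ → f +S g ≈[ n ] f′ +S g′
  +S-cong-≈[] n f≈f′ g≈g′ a b lt = L.+-cong (f≈f′ a b lt) (g≈g′ a b lt)

  +S-order : ∀ {g} f n → HasOrder n g → f +S g ≈[ n ] f
  +S-order f n g≈0 a b lt = L.trans (L.+-cong (L.refl {f a b}) (g≈0 a b lt)) (L.+-identityʳ (f a b))

  negS-order : ∀ {f} n → HasOrder n f → HasOrder n (negS f)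
  negS-order n f≈0 a b lt = L.-‿cong (f≈0 a b lt)

  +S-cancelˡ-≈[] : ∀ t {f g} n → t +S f ≈[ n ] t +S g → f ≈[ n ] g
  +S-cancelˡ-≈[] t {f} {g} n t+f≈t+g a b lt = ∙-cancelˡ (t a b) (f a b) (g a b) (t+f≈t+g a b lt)
    where open import Algebra.Properties.Group L.+-group using (∙-cancelˡ)

  *S-congˡ-≈[] : ∀ f {g g′} n → g ≈[ n ] g′ → f *S g ≈[ n ] f *S g′
  *S-congˡ-≈[] f {g} {g′} n g≈g′ a b wab<n = begin
    (f *S g) a b                                                ≈⟨ *S-coeff f g a b ⟩
    ∑ a (λ i → ∑ b (λ j → f i j ⊗ g (a ∸ i) (b ∸ j)))           ≈⟨ ∑-cong a (λ i i≤a → ∑-cong b (λ j j≤b →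
                                                                     L.*-cong (L.refl {f i j}) (g≈g′ _ _ (rest< i≤a j≤b)))) ⟩
    ∑ a (λ i → ∑ b (λ j → f i j ⊗ g′ (a ∸ i) (b ∸ j))) ≈⟨ *S-coeff f g′ a b ⟨
    (f *S g′) a b                                      ∎
    where
    open LaurentSeq using (∑; ∑-cong)
    open import Relation.Binary.Reasoning.Setoid L.setoid
    rest< : ∀ {i j} → i ≤ a → j ≤ b → w (a ∸ i) (b ∸ j) < n
    rest< {i} {j} i≤a j≤b = ℕ.≤-<-trans (≡.subst (w (a ∸ i) (b ∸ j) ≤_) (w-additive i≤a j≤b) (ℕ.m≤n+m _ (w i j))) wab<n

  order-* : ∀ {m n f g} → HasOrder m f → HasOrder n g → HasOrder (m + n) (f *S g)
  order-* {m} {n} {f} {g} f≈0 g≈0 a b wab<m+n =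
    L.trans (*S-coeff f g a b) (∑-zero a _ (λ i i≤a → ∑-zero b _ (λ j j≤b → summand i≤a j≤b)))
    where
    open LaurentSeq using (∑-zero)
    summand : ∀ {i j} → i ≤ a → j ≤ b → f i j ⊗ g (a ∸ i) (b ∸ j) ≋ zeroL
    summand {i} {j} i≤a j≤b with w i j ℕ.<? m
    ... | yes wij<m = L.trans (L.*-cong (f≈0 i j wij<m) (L.refl {g (a ∸ i) (b ∸ j)})) (L.zeroˡ (g (a ∸ i) (b ∸ j)))
    ... | no  wij≮m = L.trans (L.*-cong (L.refl {f i j}) (g≈0 _ _ rest<n)) (L.zeroʳ (f i j))
      where
      rest<n : w (a ∸ i) (b ∸ j) < n
      rest<n = ℕ.+-cancelˡ-< m _ n (ℕ.≤-<-trans (ℕ.+-monoˡ-≤ _ (ℕ.≮⇒≥ wij≮m))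
                 (≡.subst (_< m + n) (≡.sym (w-additive i≤a j≤b)) wab<m+n))

  order-zero : ∀ f → HasOrder 0 f
  order-zero f a b ()

  order-*ˡ : ∀ {n} f {g} → HasOrder n g → HasOrder n (f *S g)
  order-*ˡ f g≈0 = order-* {0} (order-zero f) g≈0

  order-*ʳ : ∀ {n f} g → HasOrder n f → HasOrder n (f *S g)
  order-*ʳ {n} {f} g f≈0 = ≡.subst (λ k → HasOrder k (f *S g)) (ℕ.+-identityʳ n) (order-* f≈0 (order-zero g))

  order-powS : ∀ {f} n → HasOrder 1 f → HasOrder n (powS f n)
  order-powS zero    f≈0 = order-zero _
  order-powS {f} (suc n) f≈0 = ≡.subst (λ k → HasOrder k (powS f (suc n))) (ℕ.+-comm n 1) (order-* (order-powS n f≈0) f≈0)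

yDegree : ℕ → ℕ → ℕ
yDegree _ b = b

totalDegree : ℕ → ℕ → ℕ
totalDegree a b = a + b

yDegree-additive : Additive yDegree
yDegree-additive _ j≤b = ℕ.m+[n∸m]≡n j≤b

totalDegree-additive : Additive totalDegree
totalDegree-additive {a} {b} {i} {j} i≤a j≤b =
  ≡.trans (interchange i j (a ∸ i) (b ∸ j)) (≡.cong₂ _+_ (ℕ.m+[n∸m]≡n i≤a) (ℕ.m+[n∸m]≡n j≤b))
  where open import Algebra.Properties.CommutativeSemigroup ℕ.+-commutativeSemigroup using (interchange)

module YOrder = Order yDegree yDegree-additive
module TOrder = Order totalDegree totalDegree-additive

-- Inverses

geometric-sum : ∀ x N → (oneS -S x) *S Series.∑ N (powS x) ≈ᴾ oneS -S powS x (suc N)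
geometric-sum x zero    = solve 1 (λ x → (con (+ 1) :- x) :* con (+ 1) := con (+ 1) :- con (+ 1) :* x) S.refl x
geometric-sum x (suc N) = begin
  (oneS -S x) *S (Series.∑ N (powS x) +S xᴺ⁺¹)
    ≈⟨ S.distribˡ (oneS -S x) (Series.∑ N (powS x)) xᴺ⁺¹ ⟩
  (oneS -S x) *S Series.∑ N (powS x) +S (oneS -S x) *S xᴺ⁺¹
    ≈⟨ S.+-cong (geometric-sum x N) (S.refl {(oneS -S x) *S xᴺ⁺¹}) ⟩
  (oneS -S xᴺ⁺¹) +S (oneS -S x) *S xᴺ⁺¹
    ≈⟨ solve 2 (λ x p → (con (+ 1) :- p) :+ (con (+ 1) :- x) :* p := con (+ 1) :- p :* x) S.refl x xᴺ⁺¹ ⟩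
  oneS -S xᴺ⁺¹ *S x ∎
  where
  open import Relation.Binary.Reasoning.Setoid S.setoid
  xᴺ⁺¹ = powS x (suc N)

inverse-unique : ∀ f {g g′} → f *S g ≈ᴾ oneS → f *S g′ ≈ᴾ oneS → g ≈ᴾ g′
inverse-unique f {g} {g′} fg≈1 fg′≈1 = begin
  g              ≈⟨ S.*-identityʳ g ⟨
  g *S oneS      ≈⟨ S.*-cong (S.refl {g}) fg′≈1 ⟨
  g *S (f *S g′) ≈⟨ S.*-assoc g f g′ ⟨
  g *S f *S g′   ≈⟨ S.*-cong (S.trans (S.*-comm g f) fg≈1) (S.refl {g′}) ⟩
  oneS *S g′     ≈⟨ S.*-identityˡ g′ ⟩
  g′             ∎
  where open import Relation.Binary.Reasoning.Setoid S.setoid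

module _ (f : PS) (u : LP) (u⊗f₀₀≋1 : u ⊗ f 0 0 ≋ oneL) where

  private
    h : PS
    h = oneS -S constS u *S f

    h-order : TOrder.HasOrder 1 h
    h-order zero zero _ = begin
      oneL ⊕ negL ((constS u *S f) 0 0) ≈⟨ L.+-cong (L.refl {oneL}) (L.-‿cong (L.trans (constS-*S u f 0 0) u⊗f₀₀≋1)) ⟩
      oneL ⊕ negL oneL                  ≈⟨ L.-‿inverseʳ oneL ⟩
      zeroL                             ∎
      where open import Relation.Binary.Reasoning.Setoid L.setoid
    h-order zero    (suc b) (s≤s ())
    h-order (suc a) b       (s≤s ())

    partial : ℕ → PS
    partial N = constS u *S Series.∑ N (powS h)

    invS≈partial : ∀ N → invS f u TOrder.≈[ suc N ] partial N
    invS≈partial N a b a+b<1+N = begin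
      u ⊗ sumTo (a + b) (λ n → powS h n a b)            ≡⟨ cong (u ⊗_) (sumTo≡∑ (a + b) _) ⟩
      u ⊗ LaurentSeq.∑ (a + b) (λ n → powS h n a b)     ≈⟨ L.*-cong (L.refl {u}) (LaurentSeq.∑-truncate N _ (ℕ.≤-pred a+b<1+N)
                                                              (λ n a+b<n → TOrder.order-powS n h-order a b a+b<n)) ⟨
      u ⊗ LaurentSeq.∑ N (λ n → powS h n a b) ≡⟨ cong (u ⊗_) (∑-coeff N (powS h) a b) ⟨
      u ⊗ Series.∑ N (powS h) a b             ≈⟨ constS-*S u (Series.∑ N (powS h)) a b ⟨
      partial N a b                           ∎
      where open import Relation.Binary.Reasoning.Setoid L.setoid

    inverse-mod : ∀ N → f *S invS f u TOrder.≈[ suc N ] oneS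
    inverse-mod N = begin
      f *S invS f u               ≈⟨ TOrder.*S-congˡ-≈[] f (suc N) (invS≈partial N) ⟩
      f *S partial N              ≈⟨ TOrder.≈ᴾ⇒≈[] (suc N) (solve 3 (λ f c g → f :* (c :* g) := (con (+ 1) :- (con (+ 1) :- c :* f)) :* g)
                                                             S.refl f (constS u) (Series.∑ N (powS h))) ⟩
      (oneS -S h) *S Series.∑ N (powS h) ≈⟨ TOrder.≈ᴾ⇒≈[] (suc N) (geometric-sum h N) ⟩
      oneS -S powS h (suc N)             ≈⟨ TOrder.+S-order oneS (suc N) (TOrder.negS-order (suc N) (TOrder.order-powS (suc N) h-order)) ⟩
      oneS                               ∎
      where open import Relation.Binary.Reasoning.Setoid (TOrder.≈[]-setoid (suc N))

  invS-inverseʳ : f *S invS f u ≈ᴾ oneS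
  invS-inverseʳ = mk≈ᴾ (λ a b → inverse-mod (a + b) a b (ℕ.n<1+n (a + b)))

-- The denominators

qint-+ : ∀ a b → qint (a + b) ≋ qint a ⊕ qpow (+ a) ⊗ qint b
qint-+ a zero    = begin
  qint (a + 0)                ≡⟨ cong qint (ℕ.+-identityʳ a) ⟩
  qint a                      ≈⟨ L.+-identityʳ (qint a) ⟨
  qint a ⊕ zeroL              ≈⟨ L.+-cong (L.refl {qint a}) (L.zeroʳ (qpow (+ a))) ⟨
  qint a ⊕ qpow (+ a) ⊗ zeroL ∎
  where open import Relation.Binary.Reasoning.Setoid L.setoid
qint-+ a (suc b) = begin
  qint (a + suc b)                                         ≡⟨ cong qint (ℕ.+-suc a b) ⟩
  qint (a + b) ⊕ qpow (+ (a + b))                          ≈⟨ L.+-cong (qint-+ a b) L.refl ⟩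
  (qint a ⊕ qpow (+ a) ⊗ qint b) ⊕ qpow (+ a) ⊗ qpow (+ b) ≈⟨ L.+-assoc (qint a) _ _ ⟩
  qint a ⊕ (qpow (+ a) ⊗ qint b ⊕ qpow (+ a) ⊗ qpow (+ b)) ≈⟨ L.+-cong (L.refl {qint a}) (L.distribˡ (qpow (+ a)) (qint b) (qpow (+ b))) ⟨
  qint a ⊕ qpow (+ a) ⊗ qint (suc b)                       ∎
  where open import Relation.Binary.Reasoning.Setoid L.setoid

qˢ : ℤ → PS
qˢ e = constS (qpow e)

[_]ˢ : ℕ → PS
[ m ]ˢ = constS (qint m)

qˢ-+ : ∀ x y → qˢ (x +ℤ y) ≈ᴾ qˢ x *S qˢ y
qˢ-+ x y = constS-⊗ (qpow x) (qpow y)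

Den-cong : ∀ j {K KA B} → qˢ (+ j) ≈ᴾ K → constS (qpow (+ j) ⊗ qint (suc j)) ≈ᴾ KA → [ j ]ˢ ≈ᴾ B →
           Den j ≈ᴾ K -S KA *S X +S B *S X *S Y
Den-cong j K≈ KA≈ B≈ =
  S.+-cong (S.+-cong K≈ (S.-‿cong (S.*-cong KA≈ (S.refl {X})))) (S.*-cong (S.*-cong B≈ (S.refl {X})) (S.refl {Y}))

Den-difference : ∀ k m → qˢ (+ suc m) *S Den k -S Den (k + suc m) ≈ᴾ [ suc m ]ˢ *S X *S (qˢ (+ (k + suc m) +ℤ + suc k) -S Y)
Den-difference k m = begin
  P *S Den k -S Den j′
    ≈⟨ S.+-cong (solve 6 (λ P K KA B X Y → P :* (K :- KA :* X :+ B :* X :* Y) := P :* K :- P :* KA :* X :+ P :* B :* X :* Y)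
                         S.refl P K KA B X Y)
                (S.-‿cong Den-j′) ⟩
  (P *S K -S P *S KA *S X +S P *S B *S X *S Y) -S (P *S K -S (P *S KA +S M *S E) *S X +S (M +S P *S B) *S X *S Y)
    ≈⟨ solve 7 (λ C b c M E X Y → (C :- b :* X :+ c :* X :* Y) :- (C :- (b :+ M :* E) :* X :+ (M :+ c) :* X :* Y) := M :* X :* (E :- Y))
               S.refl (P *S K) (P *S KA) (P *S B) M E X Y ⟩
  M *S X *S (E -S Y) ∎
  where
  open import Relation.Binary.Reasoning.Setoid S.setoid
  j′ = k + suc m
  P = qˢ (+ suc m)
  K = qˢ (+ k)
  Q = qˢ (+ suc k)
  A = [ suc k ]ˢ
  KA = constS (qpow (+ k) ⊗ qint (suc k))
  B = [ k ]ˢ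
  M = [ suc m ]ˢ
  E = qˢ (+ j′ +ℤ + suc k)
  qʲ′≈PK : qˢ (+ j′) ≈ᴾ P *S K
  qʲ′≈PK = S.trans (S.reflexive (cong (λ n → qˢ (+ n)) (ℕ.+-comm k (suc m)))) (qˢ-+ (+ suc m) (+ k))
  E≈PKQ : E ≈ᴾ P *S K *S Q
  E≈PKQ = S.trans (qˢ-+ (+ j′) (+ suc k)) (S.*-cong qʲ′≈PK (S.refl {Q}))
  x-coefficient : constS (qpow (+ j′) ⊗ qint (suc j′)) ≈ᴾ P *S KA +S M *S E
  x-coefficient = begin
    constS (qpow (+ j′) ⊗ qint (suc k + suc m))
      ≈⟨ constS-⊗ (qpow (+ j′)) (qint (suc k + suc m)) ⟩
    qˢ (+ j′) *S constS (qint (suc k + suc m))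
      ≈⟨ S.*-cong qʲ′≈PK (S.trans (constS-cong (qint-+ (suc k) (suc m)))
           (S.trans (constS-⊕ (qint (suc k)) _) (S.+-cong (S.refl {A}) (constS-⊗ (qpow (+ suc k)) (qint (suc m)))))) ⟩
    P *S K *S (A +S Q *S M)
      ≈⟨ solve 5 (λ P K A Q M → P :* K :* (A :+ Q :* M) := P :* (K :* A) :+ M :* (P :* K :* Q)) S.refl P K A Q M ⟩
    P *S (K *S A) +S M *S (P *S K *S Q)
      ≈⟨ S.+-cong (S.*-cong (S.refl {P}) (S.sym (constS-⊗ (qpow (+ k)) (qint (suc k))))) (S.*-cong (S.refl {M}) (S.sym E≈PKQ)) ⟩
    P *S KA +S M *S E ∎
  Den-j′ : Den j′ ≈ᴾ P *S K -S (P *S KA +S M *S E) *S X +S (M +S P *S B) *S X *S Y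
  Den-j′ = Den-cong j′ qʲ′≈PK x-coefficient
    (S.trans (constS-cong (L.trans (L.reflexive (cong qint (ℕ.+-comm k (suc m)))) (qint-+ (suc m) k)))
      (S.trans (constS-⊕ (qint (suc m)) _) (S.+-cong (S.refl {M}) (constS-⊗ (qpow (+ suc m)) (qint k)))))

module ProductSolver = Algebra.Solver.CommutativeMonoid S.*-commutativeMonoid
open ProductSolver using () renaming (solve to solve-*; _⊕_ to _·_; _⊜_ to _≐_; id to ε)

Den-constant : ∀ j → Den j 0 0 ≋ qpow (+ j)
Den-constant j = begin
  qpow (+ j) ⊕ negL (qpow (+ j) ⊗ qint (suc j) ⊗ zeroL) ⊕ (qint j ⊗ zeroL) ⊗ zeroL
    ≈⟨ L.+-cong (L.+-cong (L.refl {qpow (+ j)}) (L.-‿cong (L.zeroʳ (qpow (+ j) ⊗ qint (suc j))))) (L.zeroʳ (qint j ⊗ zeroL)) ⟩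
  qpow (+ j) ⊕ zeroL ⊕ zeroL
    ≈⟨ L.trans (L.+-identityʳ _) (L.+-identityʳ _) ⟩
  qpow (+ j) ∎
  where open import Relation.Binary.Reasoning.Setoid L.setoid

Den-invDen : ∀ j → Den j *S invDen j ≈ᴾ oneS
Den-invDen j = invS-inverseʳ (Den j) (qpow (-ℤ (+ j))) (L.trans (L.*-cong (L.refl {qpow (-ℤ (+ j))}) (Den-constant j))
                                                       (L.reflexive (cong qpow (ℤ.+-inverseˡ (+ j)))))

invDens : ℕ → ℕ → PS
invDens k zero    = oneS
invDens k (suc n) = invDens k n *S invDen (k + n)

invDens-suc : ∀ k n → invDens k (suc n) ≈ᴾ invDen k *S invDens (suc k) n
invDens-suc k zero    = begin
  oneS *S invDen (k + 0) ≈⟨ S.*-identityˡ (invDen (k + 0)) ⟩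
  invDen (k + 0)         ≡⟨ cong invDen (ℕ.+-identityʳ k) ⟩
  invDen k               ≈⟨ S.*-identityʳ (invDen k) ⟨
  invDen k *S oneS       ∎
  where open import Relation.Binary.Reasoning.Setoid S.setoid
invDens-suc k (suc n) = begin
  invDens k (suc n) *S invDen (k + suc n)               ≈⟨ S.*-cong (invDens-suc k n) (S.reflexive (cong invDen (ℕ.+-suc k n))) ⟩
  invDen k *S invDens (suc k) n *S invDen (suc k + n)   ≈⟨ S.*-assoc (invDen k) (invDens (suc k) n) (invDen (suc k + n)) ⟩
  invDen k *S (invDens (suc k) n *S invDen (suc k + n)) ∎
  where open import Relation.Binary.Reasoning.Setoid S.setoid

prodTo-invDen : ∀ i → prodTo i invDen ≈ᴾ invDens 0 (suc i)
prodTo-invDen zero    = S.sym (S.*-identityˡ (invDen 0))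
prodTo-invDen (suc i) = S.*-cong (prodTo-invDen i) (S.refl {invDen (suc i)})

invDens-difference : ∀ k m → qˢ (+ suc m) *S invDens (suc k) (suc m) -S invDens k (suc m)
                         ≈ᴾ [ suc m ]ˢ *S X *S (qˢ (+ (k + suc m) +ℤ + suc k) -S Y) *S invDens k (suc (suc m))
invDens-difference k m = begin
  P *S (Z *S invDen (suc k + m)) -S invDens k (suc m)
    ≈⟨ S.+-cong (S.*-cong (S.refl {P}) (S.*-cong (S.refl {Z}) (S.reflexive (cong invDen (≡.sym (ℕ.+-suc k m))))))
                (S.-‿cong (invDens-suc k m)) ⟩
  P *S (Z *S Iⱼ) -S Iₖ *S Z
    ≈⟨ S.+-cong (S.trans (S.sym (S.*-identityʳ (P *S (Z *S Iⱼ)))) (S.*-cong (S.refl {P *S (Z *S Iⱼ)}) (S.sym (Den-invDen k))))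
                (S.-‿cong (S.trans (S.sym (S.*-identityʳ (Iₖ *S Z))) (S.*-cong (S.refl {Iₖ *S Z}) (S.sym (Den-invDen j′))))) ⟩
  P *S (Z *S Iⱼ) *S (Den k *S Iₖ) -S Iₖ *S Z *S (Den j′ *S Iⱼ)
    ≈⟨ S.+-cong (solve-* 5 (λ P Z Iⱼ Dₖ Iₖ → (P · (Z · Iⱼ)) · (Dₖ · Iₖ) ≐ (P · Dₖ) · ((Iₖ · Z) · Iⱼ)) S.refl P Z Iⱼ (Den k) Iₖ)
                (S.-‿cong (solve-* 4 (λ Z Iⱼ Dⱼ Iₖ → (Iₖ · Z) · (Dⱼ · Iⱼ) ≐ Dⱼ · ((Iₖ · Z) · Iⱼ)) S.refl Z Iⱼ (Den j′) Iₖ)) ⟩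
  P *S Den k *S T -S Den j′ *S T
    ≈⟨ solve 4 (λ P Dₖ Dⱼ T → P :* Dₖ :* T :- Dⱼ :* T := (P :* Dₖ :- Dⱼ) :* T) S.refl P (Den k) (Den j′) T ⟩
  (P *S Den k -S Den j′) *S T
    ≈⟨ S.*-cong (Den-difference k m) (S.sym (S.*-cong (invDens-suc k m) (S.refl {Iⱼ}))) ⟩
  [ suc m ]ˢ *S X *S (qˢ (+ j′ +ℤ + suc k) -S Y) *S invDens k (suc (suc m)) ∎
  where
  open import Relation.Binary.Reasoning.Setoid S.setoid
  j′ = k + suc m
  P = qˢ (+ suc m)
  Z = invDens (suc k) m
  Iₖ = invDen k
  Iⱼ = invDen j′
  T = Iₖ *S Z *S Iⱼ

-- Telescoping

lhsTerm : ℕ → PS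
lhsTerm i = constS (qpow (+ i) ⊗ qfact i) *S powS X i *S powS Y i *S prodTo i invDen

rhsTerm : ℕ → PS
rhsTerm i = constS (qpow (-ℤ (+ i *ℤ + i +ℤ + i +ℤ + 1))) *S powS Y i *S (constS (qpow (+ 2 *ℤ + i +ℤ + 1)) -S Y) *S invDen i

shiftedExponent : ℕ → ℕ → ℤ
shiftedExponent k m = + m +ℤ + k -ℤ + k *ℤ + k

remainderExponent : ℕ → ℤ
remainderExponent k = -ℤ (+ k *ℤ + k +ℤ + k +ℤ + 1)

-- shiftedTerm k m and remainder k m are t k m and A k m.
shiftedTerm : ℕ → ℕ → PS
shiftedTerm k m = qˢ (shiftedExponent k m) *S constS (qfact m) *S powS X m *S powS Y (k + m) *S invDens k (suc m)

remainderMonomial : ℕ → ℕ → PS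
remainderMonomial k m = qˢ (remainderExponent k) *S constS (qfact m) *S powS X m *S powS Y (suc (k + m))

remainder : ℕ → ℕ → PS
remainder k m = remainderMonomial k m *S invDens k (suc m)

private
  shiftedExponent-suc : ∀ n k → (+ 1 +ℤ n) +ℤ k -ℤ k *ℤ k
                                ≡ -ℤ (k *ℤ k +ℤ k +ℤ + 1) +ℤ ((k +ℤ (+ 1 +ℤ n)) +ℤ (+ 1 +ℤ k))
  shiftedExponent-suc = solve-∀
  shiftedExponent-shift : ∀ n k → n +ℤ (+ 1 +ℤ k) -ℤ (+ 1 +ℤ k) *ℤ (+ 1 +ℤ k)
                                  ≡ -ℤ (k *ℤ k +ℤ k +ℤ + 1) +ℤ (+ 1 +ℤ n)
  shiftedExponent-shift = solve-∀

module _ where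
  open import Relation.Binary.Reasoning.Setoid S.setoid

  shiftedTerm-suc : ∀ k n → shiftedTerm k (suc n)
                    ≈ᴾ remainderMonomial k n *S ([ suc n ]ˢ *S X *S qˢ (+ (k + suc n) +ℤ + suc k) *S invDens k (suc (suc n)))
  shiftedTerm-suc k n = begin
    qˢ (shiftedExponent k (suc n)) *S constS (qfact n ⊗ qint (suc n)) *S (powS X n *S X) *S powS Y (k + suc n) *S Q
      ≈⟨ S.*-cong (S.*-cong (S.*-cong (S.*-cong
           (S.trans (S.reflexive (cong qˢ (shiftedExponent-suc (+ n) (+ k)))) (qˢ-+ (remainderExponent k) E))
           (constS-⊗ (qfact n) (qint (suc n))))
           (S.refl {powS X n *S X}))
           (S.reflexive (cong (powS Y) (ℕ.+-suc k n))))
           (S.refl {Q}) ⟩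
    qˢ (remainderExponent k) *S qˢ E *S (constS (qfact n) *S [ suc n ]ˢ) *S (powS X n *S X) *S powS Y (suc (k + n)) *S Q
      ≈⟨ solve-* 8 (λ U E F M Xⁿ X Yᵏ Q → ((((U · E) · (F · M)) · (Xⁿ · X)) · Yᵏ) · Q ≐ (((U · F) · Xⁿ) · Yᵏ) · (((M · X) · E) · Q))
           S.refl (qˢ (remainderExponent k)) (qˢ E) (constS (qfact n)) [ suc n ]ˢ (powS X n) X (powS Y (suc (k + n))) Q ⟩
    remainderMonomial k n *S ([ suc n ]ˢ *S X *S qˢ E *S Q) ∎
    where
    E = + (k + suc n) +ℤ + suc k
    Q = invDens k (suc (suc n))

  remainder-suc : ∀ k n → remainder k (suc n) ≈ᴾ remainderMonomial k n *S ([ suc n ]ˢ *S X *S Y *S invDens k (suc (suc n)))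
  remainder-suc k n = begin
    qˢ (remainderExponent k) *S constS (qfact n ⊗ qint (suc n)) *S (powS X n *S X) *S (powS Y (k + suc n) *S Y) *S Q
      ≈⟨ S.*-cong (S.*-cong (S.*-cong (S.*-cong (S.refl {qˢ (remainderExponent k)}) (constS-⊗ (qfact n) (qint (suc n))))
           (S.refl {powS X n *S X}))
           (S.*-cong (S.reflexive (cong (powS Y) (ℕ.+-suc k n))) (S.refl {Y})))
           (S.refl {Q}) ⟩
    qˢ (remainderExponent k) *S (constS (qfact n) *S [ suc n ]ˢ) *S (powS X n *S X) *S (powS Y (suc (k + n)) *S Y) *S Q
      ≈⟨ solve-* 8 (λ U F M Xⁿ X Yᵏ Y Q → (((U · (F · M)) · (Xⁿ · X)) · (Yᵏ · Y)) · Q ≐ (((U · F) · Xⁿ) · Yᵏ) · (((M · X) · Y) · Q))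
           S.refl (qˢ (remainderExponent k)) (constS (qfact n)) [ suc n ]ˢ (powS X n) X (powS Y (suc (k + n))) Y Q ⟩
    remainderMonomial k n *S ([ suc n ]ˢ *S X *S Y *S Q) ∎
    where
    Q = invDens k (suc (suc n))

  shiftedTerm-shift : ∀ k n → shiftedTerm (suc k) n ≈ᴾ remainderMonomial k n *S (qˢ (+ suc n) *S invDens (suc k) (suc n))
  shiftedTerm-shift k n = begin
    qˢ (shiftedExponent (suc k) n) *S constS (qfact n) *S powS X n *S powS Y (suc (k + n)) *S Q
      ≈⟨ S.*-cong (S.*-cong (S.*-cong (S.*-cong
           (S.trans (S.reflexive (cong qˢ (shiftedExponent-shift (+ n) (+ k)))) (qˢ-+ (remainderExponent k) (+ suc n)))
           (S.refl {constS (qfact n)})) (S.refl {powS X n})) (S.refl {powS Y (suc (k + n))})) (S.refl {Q}) ⟩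
    qˢ (remainderExponent k) *S qˢ (+ suc n) *S constS (qfact n) *S powS X n *S powS Y (suc (k + n)) *S Q
      ≈⟨ solve-* 6 (λ U P F Xⁿ Yᵏ Q → ((((U · P) · F) · Xⁿ) · Yᵏ) · Q ≐ (((U · F) · Xⁿ) · Yᵏ) · (P · Q))
           S.refl (qˢ (remainderExponent k)) (qˢ (+ suc n)) (constS (qfact n)) (powS X n) (powS Y (suc (k + n))) Q ⟩
    remainderMonomial k n *S (qˢ (+ suc n) *S Q) ∎
    where
    Q = invDens (suc k) (suc n)

  shiftedTerm-step : ∀ k n → shiftedTerm k (suc n) +S remainder k n ≈ᴾ remainder k (suc n) +S shiftedTerm (suc k) n
  shiftedTerm-step k n = begin
    shiftedTerm k (suc n) +S G *S Q₁             ≈⟨ S.+-cong (shiftedTerm-suc k n) (S.refl {G *S Q₁}) ⟩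
    G *S (N *S E *S Q₂) +S G *S Q₁               ≈⟨ S.distribˡ G (N *S E *S Q₂) Q₁ ⟨
    G *S (N *S E *S Q₂ +S Q₁)                    ≈⟨ S.*-cong (S.refl {G}) key ⟩
    G *S (N *S Y *S Q₂ +S P *S Q₁′)              ≈⟨ S.distribˡ G (N *S Y *S Q₂) (P *S Q₁′) ⟩
    G *S (N *S Y *S Q₂) +S G *S (P *S Q₁′)       ≈⟨ S.+-cong (remainder-suc k n) (shiftedTerm-shift k n) ⟨
    remainder k (suc n) +S shiftedTerm (suc k) n ∎
    where
    G = remainderMonomial k n
    N = [ suc n ]ˢ *S X
    E = qˢ (+ (k + suc n) +ℤ + suc k)
    P = qˢ (+ suc n)
    Q₁ = invDens k (suc n)
    Q₁′ = invDens (suc k) (suc n)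
    Q₂ = invDens k (suc (suc n))
    key : N *S E *S Q₂ +S Q₁ ≈ᴾ N *S Y *S Q₂ +S P *S Q₁′
    key = begin
      N *S E *S Q₂ +S Q₁
        ≈⟨ solve 5 (λ N E Y Q₂ Q₁ → N :* E :* Q₂ :+ Q₁ := N :* Y :* Q₂ :+ (Q₁ :+ N :* (E :- Y) :* Q₂)) S.refl N E Y Q₂ Q₁ ⟩
      N *S Y *S Q₂ +S (Q₁ +S N *S (E -S Y) *S Q₂)
        ≈⟨ S.+-cong (S.refl {N *S Y *S Q₂}) (S.+-cong (S.refl {Q₁}) (invDens-difference k n)) ⟨
      N *S Y *S Q₂ +S (Q₁ +S (P *S Q₁′ -S Q₁))
        ≈⟨ S.+-cong (S.refl {N *S Y *S Q₂}) (solve 2 (λ Q₁ R → Q₁ :+ (R :- Q₁) := R) S.refl Q₁ (P *S Q₁′)) ⟩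
      N *S Y *S Q₂ +S P *S Q₁′ ∎

private
  shiftedExponent-zero : ∀ k → + 0 +ℤ k -ℤ k *ℤ k ≡ -ℤ (k *ℤ k +ℤ k +ℤ + 1) +ℤ (+ 2 *ℤ k +ℤ + 1)
  shiftedExponent-zero = solve-∀

module _ where
  open import Relation.Binary.Reasoning.Setoid S.setoid

  rhsTerm+remainder₀ : ∀ k → rhsTerm k +S remainder k 0 ≈ᴾ shiftedTerm k 0
  rhsTerm+remainder₀ k = begin
    U *S Yᵏ *S (T -S Y) *S I +S remainder k 0
      ≈⟨ S.+-cong (S.refl {U *S Yᵏ *S (T -S Y) *S I}) (begin
           U *S oneS *S oneS *S (powS Y (k + 0) *S Y) *S (oneS *S invDen (k + 0))
             ≈⟨ S.*-cong (S.*-cong (S.refl {U *S oneS *S oneS}) (S.*-cong Yᵏ⁺⁰≈Yᵏ (S.refl {Y}))) (S.*-cong (S.refl {oneS}) Iᵏ⁺⁰≈I) ⟩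
           U *S oneS *S oneS *S (Yᵏ *S Y) *S (oneS *S I)
             ≈⟨ solve-* 4 (λ U Yᵏ Y I → (((U · ε) · ε) · (Yᵏ · Y)) · (ε · I) ≐ ((U · Yᵏ) · Y) · I) S.refl U Yᵏ Y I ⟩
           U *S Yᵏ *S Y *S I ∎) ⟩
    U *S Yᵏ *S (T -S Y) *S I +S U *S Yᵏ *S Y *S I
      ≈⟨ solve 5 (λ U Yᵏ T Y I → U :* Yᵏ :* (T :- Y) :* I :+ U :* Yᵏ :* Y :* I := U :* T :* Yᵏ :* I) S.refl U Yᵏ T Y I ⟩
    U *S T *S Yᵏ *S I
      ≈⟨ (begin
           qˢ (shiftedExponent k 0) *S oneS *S oneS *S powS Y (k + 0) *S (oneS *S invDen (k + 0))
             ≈⟨ S.*-cong (S.*-cong (S.*-cong (S.*-cong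
                  (S.trans (S.reflexive (cong qˢ (shiftedExponent-zero (+ k)))) (qˢ-+ (remainderExponent k) _))
                  (S.refl {oneS})) (S.refl {oneS})) Yᵏ⁺⁰≈Yᵏ) (S.*-cong (S.refl {oneS}) Iᵏ⁺⁰≈I) ⟩
           U *S T *S oneS *S oneS *S Yᵏ *S (oneS *S I)
             ≈⟨ solve-* 4 (λ U T Yᵏ I → ((((U · T) · ε) · ε) · Yᵏ) · (ε · I) ≐ ((U · T) · Yᵏ) · I) S.refl U T Yᵏ I ⟩
           U *S T *S Yᵏ *S I ∎) ⟨
    shiftedTerm k 0 ∎
    where
    U = qˢ (remainderExponent k)
    T = qˢ (+ 2 *ℤ + k +ℤ + 1)
    Yᵏ = powS Y k
    I = invDen k
    Yᵏ⁺⁰≈Yᵏ : powS Y (k + 0) ≈ᴾ Yᵏ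
    Yᵏ⁺⁰≈Yᵏ = S.reflexive (cong (powS Y) (ℕ.+-identityʳ k))
    Iᵏ⁺⁰≈I : invDen (k + 0) ≈ᴾ I
    Iᵏ⁺⁰≈I = S.reflexive (cong invDen (ℕ.+-identityʳ k))

  ∑-shiftedTerm : ∀ M k → Series.∑ (suc M) (shiftedTerm k) ≈ᴾ rhsTerm k +S remainder k (suc M) +S Series.∑ M (shiftedTerm (suc k))
  ∑-shiftedTerm zero    k = begin
    shiftedTerm k 0 +S shiftedTerm k 1
      ≈⟨ S.+-cong (rhsTerm+remainder₀ k) (S.refl {shiftedTerm k 1}) ⟨
    rhsTerm k +S remainder k 0 +S shiftedTerm k 1
      ≈⟨ S.+-assoc (rhsTerm k) (remainder k 0) (shiftedTerm k 1) ⟩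
    rhsTerm k +S (remainder k 0 +S shiftedTerm k 1)
      ≈⟨ S.+-cong (S.refl {rhsTerm k}) (S.trans (S.+-comm (remainder k 0) (shiftedTerm k 1)) (shiftedTerm-step k 0)) ⟩
    rhsTerm k +S (remainder k 1 +S shiftedTerm (suc k) 0)
      ≈⟨ S.+-assoc (rhsTerm k) (remainder k 1) (shiftedTerm (suc k) 0) ⟨
    rhsTerm k +S remainder k 1 +S shiftedTerm (suc k) 0 ∎
  ∑-shiftedTerm (suc M) k = begin
    Series.∑ (suc M) (shiftedTerm k) +S shiftedTerm k (2+ M)
      ≈⟨ S.+-cong (∑-shiftedTerm M k) (S.refl {shiftedTerm k (2+ M)}) ⟩
    rhsTerm k +S remainder k (suc M) +S Σ′ +S shiftedTerm k (2+ M)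
      ≈⟨ solve 4 (λ r a s t → r :+ a :+ s :+ t := r :+ (t :+ a) :+ s) S.refl (rhsTerm k) (remainder k (suc M)) Σ′ (shiftedTerm k (2+ M)) ⟩
    rhsTerm k +S (shiftedTerm k (2+ M) +S remainder k (suc M)) +S Σ′
      ≈⟨ S.+-cong (S.+-cong (S.refl {rhsTerm k}) (shiftedTerm-step k (suc M))) (S.refl {Σ′}) ⟩
    rhsTerm k +S (remainder k (2+ M) +S shiftedTerm (suc k) (suc M)) +S Σ′
      ≈⟨ solve 4 (λ r a t s → r :+ (a :+ t) :+ s := r :+ a :+ (s :+ t)) S.refl (rhsTerm k) (remainder k (2+ M)) (shiftedTerm (suc k) (suc M)) Σ′ ⟩
    rhsTerm k +S remainder k (2+ M) +S Series.∑ (suc M) (shiftedTerm (suc k)) ∎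
    where
    Σ′ = Series.∑ M (shiftedTerm (suc k))
    2+ : ℕ → ℕ
    2+ n = suc (suc n)

Y-order : YOrder.HasOrder 1 Y
Y-order zero    zero    _ = L.refl
Y-order (suc a) zero    _ = L.refl
Y-order a       (suc b) (s≤s ())

remainder-order : ∀ k m → YOrder.HasOrder (suc (k + m)) (remainder k m)
remainder-order k m = YOrder.order-*ʳ (invDens k (suc m))
  (YOrder.order-*ˡ (qˢ (remainderExponent k) *S constS (qfact m) *S powS X m) (YOrder.order-powS (suc (k + m)) Y-order))

telescope : ∀ M k → Series.∑ M (shiftedTerm k) YOrder.≈[ suc (k + M) ] Series.∑ M (λ i → rhsTerm (i + k))
telescope zero    k = begin
  shiftedTerm k 0            ≈⟨ YOrder.≈ᴾ⇒≈[] _ (rhsTerm+remainder₀ k) ⟨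
  rhsTerm k +S remainder k 0 ≈⟨ YOrder.+S-order (rhsTerm k) _ (remainder-order k 0) ⟩
  rhsTerm k                  ∎
  where open import Relation.Binary.Reasoning.Setoid (YOrder.≈[]-setoid (suc (k + 0)))
telescope (suc M) k = begin
  Series.∑ (suc M) (shiftedTerm k)
    ≈⟨ YOrder.≈ᴾ⇒≈[] n (∑-shiftedTerm M k) ⟩
  rhsTerm k +S remainder k (suc M) +S Series.∑ M (shiftedTerm (suc k))
    ≈⟨ YOrder.+S-cong-≈[] n (YOrder.+S-order (rhsTerm k) n (remainder-order k (suc M))) tail ⟩
  rhsTerm k +S Series.∑ M (λ i → rhsTerm (i + suc k))
    ≈⟨ YOrder.≈ᴾ⇒≈[] n (S.+-cong (S.refl {rhsTerm k}) (Series.∑-congᵖ M (λ i → S.reflexive (cong rhsTerm (ℕ.+-suc i k))))) ⟩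
  rhsTerm k +S Series.∑ M (λ i → rhsTerm (suc i + k))
    ≈⟨ YOrder.≈ᴾ⇒≈[] n (Series.∑-peel M (λ i → rhsTerm (i + k))) ⟨
  Series.∑ (suc M) (λ i → rhsTerm (i + k)) ∎
  where
  n = suc (k + suc M)
  open import Relation.Binary.Reasoning.Setoid (YOrder.≈[]-setoid n)
  tail : Series.∑ M (shiftedTerm (suc k)) YOrder.≈[ n ] Series.∑ M (λ i → rhsTerm (i + suc k))
  tail = ≡.subst (λ n → Series.∑ M (shiftedTerm (suc k)) YOrder.≈[ n ] Series.∑ M (λ i → rhsTerm (i + suc k)))
                 (cong suc (≡.sym (ℕ.+-suc k M))) (telescope M (suc k))

Den-zero : Den 0 ≈ᴾ oneS -S X
Den-zero = begin
  Den 0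
    ≈⟨ Den-cong 0 (S.refl {oneS}) (constS-cong (L.trans (L.*-identityˡ _) (L.+-identityˡ oneL))) constS-zeroL ⟩
  oneS -S oneS *S X +S zeroS *S X *S Y
    ≈⟨ S.+-cong (S.+-cong (S.refl {oneS}) (S.-‿cong (S.*-identityˡ X)))
                (S.trans (S.*-cong (S.zeroˡ X) (S.refl {Y})) (S.zeroˡ Y)) ⟩
  oneS -S X +S zeroS
    ≈⟨ S.+-identityʳ (oneS -S X) ⟩
  oneS -S X ∎
  where open import Relation.Binary.Reasoning.Setoid S.setoid

invS[1-X]≈invDen0 : invS (oneS -S X) oneL ≈ᴾ invDen 0
invS[1-X]≈invDen0 = inverse-unique (oneS -S X)
  (invS-inverseʳ (oneS -S X) oneL (L.trans (L.*-identityˡ _) (L.+-identityʳ oneL)))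
  (S.trans (S.*-cong (S.sym Den-zero) (S.refl {invDen 0})) (Den-invDen 0))

rhsHead : PS
rhsHead = constS (negL (qpow -[1+ 0 ])) *S Y *S invS (oneS -S X) oneL

rhsTerm₀≈shiftedTerm₀+rhsHead : rhsTerm 0 ≈ᴾ shiftedTerm 0 0 +S rhsHead
rhsTerm₀≈shiftedTerm₀+rhsHead = begin
  a *S oneS *S (b -S Y) *S I₀
    ≈⟨ solve 4 (λ a b y i → a :* con (+ 1) :* (b :- y) :* i := a :* b :* i :- a :* y :* i) S.refl a b Y I₀ ⟩
  a *S b *S I₀ -S a *S Y *S I₀
    ≈⟨ S.+-cong (S.*-cong (S.sym (qˢ-+ -[1+ 0 ] (+ 1))) (S.refl {I₀})) (S.refl {negS (a *S Y *S I₀)}) ⟩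
  oneS *S I₀ -S a *S Y *S I₀
    ≈⟨ solve 3 (λ a y i → con (+ 1) :* i :- a :* y :* i
                       := con (+ 1) :* con (+ 1) :* con (+ 1) :* con (+ 1) :* (con (+ 1) :* i) :+ :- a :* y :* i) S.refl a Y I₀ ⟩
  shiftedTerm 0 0 +S negS a *S Y *S I₀
    ≈⟨ S.+-cong (S.refl {shiftedTerm 0 0}) (S.*-cong (S.*-cong (constS-negL (qpow -[1+ 0 ])) (S.refl {Y})) invS[1-X]≈invDen0) ⟨
  shiftedTerm 0 0 +S rhsHead ∎
  where
  open import Relation.Binary.Reasoning.Setoid S.setoid
  open RingSolver using (:-_)
  a = qˢ -[1+ 0 ]
  b = qˢ (+ 1)
  I₀ = invDen 0

shiftedTerm₀≈lhsTerm : ∀ m → shiftedTerm 0 m ≈ᴾ lhsTerm m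
shiftedTerm₀≈lhsTerm m = S.*-cong (S.*-cong (S.*-cong
  (S.trans (S.*-cong (S.reflexive (cong qˢ shiftedExponent-base)) (S.refl {constS (qfact m)})) (S.sym (constS-⊗ (qpow (+ m)) (qfact m))))
  (S.refl {powS X m})) (S.refl {powS Y m})) (S.sym (prodTo-invDen m))
  where
  shiftedExponent-base : shiftedExponent 0 m ≡ + m
  shiftedExponent-base = cong +_ (≡.trans (ℕ.+-identityʳ (m + 0)) (ℕ.+-identityʳ m))

partial-sums-agree : ∀ N → Series.∑ N (λ i → lhsTerm (suc i))
                             YOrder.≈[ suc (suc N) ] rhsHead +S Series.∑ N (λ i → rhsTerm (suc i))
partial-sums-agree N = begin
  Series.∑ N (λ i → lhsTerm (suc i))       ≈⟨ YOrder.≈ᴾ⇒≈[] n (Series.∑-congᵖ N (λ i → shiftedTerm₀≈lhsTerm (suc i))) ⟨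
  Series.∑ N (λ i → shiftedTerm 0 (suc i)) ≈⟨ YOrder.+S-cancelˡ-≈[] (shiftedTerm 0 0) n shifted ⟩
  rhsHead +S R                             ∎
  where
  n = suc (suc N)
  R = Series.∑ N (λ i → rhsTerm (suc i))
  open import Relation.Binary.Reasoning.Setoid (YOrder.≈[]-setoid n)
  shifted : shiftedTerm 0 0 +S Series.∑ N (λ i → shiftedTerm 0 (suc i)) YOrder.≈[ n ] shiftedTerm 0 0 +S (rhsHead +S R)
  shifted = begin
    shiftedTerm 0 0 +S Series.∑ N (λ i → shiftedTerm 0 (suc i))
      ≈⟨ YOrder.≈ᴾ⇒≈[] n (Series.∑-peel N (shiftedTerm 0)) ⟨
    Series.∑ (suc N) (shiftedTerm 0)
      ≈⟨ telescope (suc N) 0 ⟩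
    Series.∑ (suc N) (λ i → rhsTerm (i + 0))
      ≈⟨ YOrder.≈ᴾ⇒≈[] n (Series.∑-peel N (λ i → rhsTerm (i + 0))) ⟩
    rhsTerm 0 +S Series.∑ N (λ i → rhsTerm (suc i + 0))
      ≈⟨ YOrder.≈ᴾ⇒≈[] n (S.+-cong rhsTerm₀≈shiftedTerm₀+rhsHead
           (Series.∑-congᵖ N (λ i → S.reflexive (cong rhsTerm (ℕ.+-identityʳ (suc i)))))) ⟩
    shiftedTerm 0 0 +S rhsHead +S R
      ≈⟨ YOrder.≈ᴾ⇒≈[] n (S.+-assoc (shiftedTerm 0 0) rhsHead R) ⟩
    shiftedTerm 0 0 +S (rhsHead +S R) ∎

tsum1-∑ : ∀ T a b → tsum1 T a b ≡ Series.∑ (a + b) (λ i → T (suc i)) a b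
tsum1-∑ T a b = ≡.trans (sumTo≡∑ (a + b) (λ i → T (suc i) a b)) (≡.sym (∑-coeff (a + b) (λ i → T (suc i)) a b))

theorem4p12 : tsum1 (λ i → constS (qpow (+ i) ⊗ qfact i) *S powS X i *S powS Y i *S prodTo i invDen)
    ≈S (constS (negL (qpow (-[1+ 0 ]))) *S Y *S invS (oneS -S X) oneL
        +S tsum1 (λ i → constS (qpow (-ℤ (+ i *ℤ + i +ℤ + i +ℤ + 1))) *S powS Y i
                          *S (constS (qpow (+ 2 *ℤ + i +ℤ + 1)) -S Y) *S invDen i))
theorem4p12 a b = un≋ (begin
  tsum1 lhsTerm a b                                         ≡⟨ tsum1-∑ lhsTerm a b ⟩
  Series.∑ (a + b) (λ i → lhsTerm (suc i)) a b              ≈⟨ partial-sums-agree (a + b) a b (s≤s (ℕ.m≤n⇒m≤1+n (ℕ.m≤n+m b a))) ⟩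
  (rhsHead +S Series.∑ (a + b) (λ i → rhsTerm (suc i))) a b ≡⟨ cong (rhsHead a b ⊕_) (tsum1-∑ rhsTerm a b) ⟨
  (rhsHead +S tsum1 rhsTerm) a b                            ∎)
  where open import Relation.Binary.Reasoning.Setoid L.setoid
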